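{- For every integer $d\ge2$ there exists a constant $c>0$ such that the following holds for every prime power $q \ge 2(d+1)$: if $P\subset\mathbb{F}_{q}^d$ has size at least $q+2(d+1)$, then the number of coplanar $(d+1)$-tuples contained in $P$ is at least \[ c \cdot \min\left\{\frac{|P|}{q}-1,\,1\right\} \cdot \frac{|P|^{d+1}}{q}. \]
   Context: A hyperplane in $\mathbb{F}_q^d$ is a $(d-1)$-dimensional affine subspace. A coplanar $(d+1)$-tuple is an (unordered) set of $d+1$ distinct points contained in some hyperplane. -}

module Defs where

open import Level using (0ℓ)
open import Data.Nat as ℕ using (ℕ; zero; suc)
open import Data.Fin using (Fin)
open import Data.Fin.Properties using (any?) renaming (_≟_ to _≟ᶠ_)
open import Data.Vec as Vec using (Vec; []; _∷_; zipWith; foldr; replicate)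
open import Data.Vec.Properties using (≡-dec)
open import Data.List as List using (List; []; _∷_; _++_; map; filter; length)
open import Data.List.Relation.Unary.All using (All; all?)
open import Data.Product using (Σ; ∃; _×_; _,_; proj₁; proj₂)
open import Relation.Nullary using (¬_; Dec; yes; no)
open import Relation.Nullary.Decidable using (_×-dec_; ¬?)
import Relation.Nullary.Decidable as Dec
open import Relation.Unary using (Pred; Decidable)
open import Relation.Binary.PropositionalEquality using (_≡_; _≢_; refl)
open import Algebra.Structures using (IsCommutativeRing)

-- Every finite field F_q is isomorphic to such a structure, and such a
-- structure exists exactly when q is a prime power.
record FieldOn (q : ℕ) : Set where
  field
    _+_ _*_ : Fin q → Fin q → Fin q
    -_      : Fin q → Fin q
    0# 1#   : Fin q
    isCommutativeRing : IsCommutativeRing _≡_ _+_ _*_ -_ 0# 1#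
    0≢1     : 0# ≢ 1#
    inverse : ∀ x → x ≢ 0# → ∃ λ y → x * y ≡ 1#

module _ {q : ℕ} (F : FieldOn q) where
  open FieldOn F

  Point : ℕ → Set
  Point d = Vec (Fin q) d

  dot : ∀ {d} → Point d → Point d → Fin q
  dot a x = foldr _ _+_ 0# (zipWith _*_ a x)

  zeroVec : ∀ d → Point d
  zeroVec d = replicate d 0#

  -- the hyperplane { x | a · x = b } with a ≠ 0 (every (d-1)-dim affine
  -- subspace of F_q^d is of this form)
  InHyperplane : ∀ {d} → Point d → Fin q → Point d → Set
  InHyperplane a b x = dot a x ≡ b

  Coplanar : ∀ d → List (Point d) → Set
  Coplanar d S = Σ (Point d) λ a → Σ (Fin q) λ b →
                   a ≢ zeroVec d × All (InHyperplane a b) S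

∃vec? : ∀ {q} d {P : Pred (Vec (Fin q) d) 0ℓ} → Decidable P → Dec (∃ P)
∃vec? zero {P} P? = Dec.map′ (λ p → [] , p) (λ { ([] , p) → p }) (P? [])
∃vec? {q} (suc d) {P} P? =
  Dec.map′ (λ { (x , v , p) → (x ∷ v) , p })
           (λ { ((x ∷ v) , p) → x , v , p })
           (any? (λ x → ∃vec? d (λ v → P? (x ∷ v))))

module _ {q : ℕ} (F : FieldOn q) where
  open FieldOn F

  coplanar? : ∀ d → (S : List (Point F d)) → Dec (Coplanar F d S)
  coplanar? d S =
    Dec.map′ (λ { (a , b , p) → a , b , p }) (λ { (a , b , p) → a , b , p })
      (∃vec? d (λ a → any? (λ b →
         ¬? (≡-dec _≟ᶠ_ a (zeroVec F d)) ×-dec all? (λ x → dot F a x ≟ᶠ b) S)))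

-- all k-element sublists (order preserved) of a list; for a duplicate-free
-- list these correspond bijectively to the k-element subsets
combinations : ∀ {A : Set} → ℕ → List A → List (List A)
combinations zero    xs       = [] ∷ []
combinations (suc k) []       = []
combinations (suc k) (x ∷ xs) = map (x ∷_) (combinations k xs) ++ combinations (suc k) xs

coplanarCount : ∀ {q} (F : FieldOn q) d → List (Point F d) → ℕ
coplanarCount F d P = length (filter (coplanar? F d) (combinations (suc d) P))

-- Fix a set T of d − 1 points of P. In homogeneous coordinates x ↦ (1, x), two independent
-- linear forms vanishing on T span a pencil of q + 1 hyperplanes through T which together cover
-- F_q^d. Sorting the other m = |P| − d + 1 points of P into these hyperplanes, T together with
-- two points of the same hyperplane is a coplanar (d + 1)-set, and Cauchy–Schwarz yields at
-- least m (m − q − 1) / (2 (q + 1)) such pairs. Summing over all T counts each coplanar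
-- (d + 1)-set C(d + 1, 2) times; together with C(|P|, d − 1) ≥ (|P| − d + 1)^(d−1) / (d − 1)!
-- this gives a count of order (|P| − q) |P|^d / q, which dominates min(|P|/q − 1, 1) |P|^(d+1) / q
-- both when |P| ≤ 2q and when |P| > 2q.

module Submission where

open import Defs
open import Data.Nat.Base using (ℕ)

module Binomial where

  open import Data.Nat.Base using (zero; suc; _+_; _*_; _∸_; _^_; _!; _≤_; z≤n)
  open import Data.Nat.Properties
  open import Data.Nat.Combinatorics using (_C_; nC1≡n; nCk+nC[k+1]≡[n+1]C[k+1])
  open import Data.Nat.Tactic.RingSolver using (solve-∀)
  open import Relation.Binary.PropositionalEquality
  open import Algebra.Properties.CommutativeSemigroup *-commutativeSemigroup using (x∙yz≈y∙xz)

  pascal : ∀ n k → suc n C suc k ≡ n C suc k + n C k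
  pascal n k = trans (sym (nCk+nC[k+1]≡[n+1]C[k+1] n k)) (+-comm (n C k) _)

  [k+1]*[n+1]C[k+1] : ∀ n k → suc k * (suc n C suc k) ≡ suc n * (n C k)
  [k+1]*[n+1]C[k+1] zero    zero    = refl
  [k+1]*[n+1]C[k+1] zero    (suc k) = *-zeroʳ (suc (suc k))
  [k+1]*[n+1]C[k+1] (suc n) zero    = trans (*-identityˡ _) (trans (nC1≡n (suc (suc n))) (sym (*-identityʳ _)))
  [k+1]*[n+1]C[k+1] (suc n) (suc k) = begin
    suc (suc k) * (suc (suc n) C suc (suc k))
      ≡⟨ cong (suc (suc k) *_) (trans (pascal (suc n) (suc k)) (+-comm Y X)) ⟩
    suc (suc k) * (X + Y)
      ≡⟨ split k X Y ⟩
    X + suc k * X + suc (suc k) * Y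
      ≡⟨ cong₂ (λ u v → X + u + v) ([k+1]*[n+1]C[k+1] n k) ([k+1]*[n+1]C[k+1] n (suc k)) ⟩
    X + suc n * (n C k) + suc n * (n C suc k)
      ≡⟨ merge X n (n C k) (n C suc k) ⟩
    X + suc n * (n C suc k + n C k)
      ≡⟨ cong (λ c → X + suc n * c) (sym (pascal n k)) ⟩
    suc (suc n) * X ∎
    where
    open ≡-Reasoning
    X = suc n C suc k
    Y = suc n C suc (suc k)
    split : ∀ k X Y → suc (suc k) * (X + Y) ≡ X + suc k * X + suc (suc k) * Y
    split = solve-∀
    merge : ∀ X n A B → X + suc n * A + suc n * B ≡ X + suc n * (B + A)
    merge = solve-∀

  [n∸k]^k≤k!*nCk : ∀ n k → (n ∸ k) ^ k ≤ k ! * (n C k)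
  [n∸k]^k≤k!*nCk n       zero    = ≤-refl
  [n∸k]^k≤k!*nCk zero    (suc k) = z≤n
  [n∸k]^k≤k!*nCk (suc n) (suc k) = begin
    (n ∸ k) * (n ∸ k) ^ k                  ≤⟨ *-mono-≤ (≤-trans (m∸n≤m n k) (n≤1+n n)) ([n∸k]^k≤k!*nCk n k) ⟩
    suc n * (k ! * (n C k))                ≡⟨ x∙yz≈y∙xz (suc n) (k !) (n C k) ⟩
    k ! * (suc n * (n C k))                ≡⟨ cong (k ! *_) (sym ([k+1]*[n+1]C[k+1] n k)) ⟩
    k ! * (suc k * (suc n C suc k))        ≡⟨ sym (trans (*-assoc (suc k) (k !) _) (x∙yz≈y∙xz (suc k) (k !) _)) ⟩
    suc k ! * (suc n C suc k)              ∎
    where open ≤-Reasoning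

  [m*n]^k≡m^k*n^k : ∀ m n k → (m * n) ^ k ≡ m ^ k * n ^ k
  [m*n]^k≡m^k*n^k m n zero    = refl
  [m*n]^k≡m^k*n^k m n (suc k) = trans (cong (m * n *_) ([m*n]^k≡m^k*n^k m n k)) (shuffle m n (m ^ k) (n ^ k))
    where
    shuffle : ∀ a b x y → a * b * (x * y) ≡ a * x * (b * y)
    shuffle = solve-∀

  n^k≤2^k*k!*nCk : ∀ {n k} → n ≤ 2 * (n ∸ k) → n ^ k ≤ 2 ^ k * (k ! * (n C k))
  n^k≤2^k*k!*nCk {n} {k} n≤2[n∸k] = begin
    n ^ k                   ≤⟨ ^-monoˡ-≤ k n≤2[n∸k] ⟩
    (2 * (n ∸ k)) ^ k       ≡⟨ [m*n]^k≡m^k*n^k 2 (n ∸ k) k ⟩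
    2 ^ k * (n ∸ k) ^ k     ≤⟨ *-monoʳ-≤ (2 ^ k) ([n∸k]^k≤k!*nCk n k) ⟩
    2 ^ k * (k ! * (n C k)) ∎
    where open ≤-Reasoning

  n²≡2[nC2]+n : ∀ n → n * n ≡ 2 * (n C 2) + n
  n²≡2[nC2]+n zero    = refl
  n²≡2[nC2]+n (suc n) = begin
    suc n * suc n                     ≡⟨ square-suc n ⟩
    n * n + 2 * n + 1                 ≡⟨ cong (λ x → x + 2 * n + 1) (n²≡2[nC2]+n n) ⟩
    2 * (n C 2) + n + 2 * n + 1       ≡⟨ regroup (n C 2) n ⟩
    2 * (n C 2 + n) + suc n           ≡⟨ cong (λ x → 2 * (n C 2 + x) + suc n) (sym (nC1≡n n)) ⟩
    2 * (n C 2 + n C 1) + suc n       ≡⟨ cong (λ x → 2 * x + suc n) (sym (pascal n 1)) ⟩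
    2 * (suc n C 2) + suc n           ∎
    where
    open ≡-Reasoning
    square-suc : ∀ n → suc n * suc n ≡ n * n + 2 * n + 1
    square-suc = solve-∀
    regroup : ∀ c n → 2 * c + n + 2 * n + 1 ≡ 2 * (c + n) + suc n
    regroup = solve-∀

module SubsetSum where

  open import Data.Bool.Base using (Bool; true; false; not; _∧_; _∨_; T)
  open import Data.Nat.Base using (ℕ; zero; suc; _+_; _*_; _≡ᵇ_; _≤_; z≤n; s≤s)
  open import Data.Nat.Properties
  open import Data.Nat.Combinatorics using (_C_)
  open import Data.Fin.Subset using (Subset; ∣_∣; _∪_; _∩_; ∁)
  open import Data.Vec.Base using ([]; _∷_)
  open import Data.Product.Base using (_×_; _,_)
  open import Relation.Binary.PropositionalEquality
  open import Algebra.Properties.CommutativeSemigroup +-commutativeSemigroup using (interchange)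
  open Binomial using (pascal)

  private variable n : ℕ

  ⟦_⟧ : Bool → ℕ
  ⟦ true  ⟧ = 1
  ⟦ false ⟧ = 0

  1≤⟦⟧ : ∀ {x} → x ≡ true → 1 ≤ ⟦ x ⟧
  1≤⟦⟧ refl = s≤s z≤n

  ⟦⟧≤1 : ∀ x → ⟦ x ⟧ ≤ 1
  ⟦⟧≤1 false = z≤n
  ⟦⟧≤1 true  = s≤s z≤n

  1≤⟦≡ᵇ⟧ : ∀ {m k} → m ≡ k → 1 ≤ ⟦ m ≡ᵇ k ⟧
  1≤⟦≡ᵇ⟧ {zero}  refl = s≤s z≤n
  1≤⟦≡ᵇ⟧ {suc m} refl = 1≤⟦≡ᵇ⟧ {m} refl

  ≡ᵇ-true⇒≡ : ∀ {m k} → (m ≡ᵇ k) ≡ true → m ≡ k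
  ≡ᵇ-true⇒≡ {m} {k} eq = ≡ᵇ⇒≡ m k (subst T (sym eq) _)

  infix 5 _⊆ᵇ_

  _⊆ᵇ_ : Subset n → Subset n → Bool
  []      ⊆ᵇ []      = true
  (x ∷ p) ⊆ᵇ (y ∷ q) = (not x ∨ y) ∧ (p ⊆ᵇ q)

  ⊆ᵇ-∩ : ∀ {n} (R U V : Subset n) → R ⊆ᵇ U ∩ V ≡ true → R ⊆ᵇ U ≡ true × R ⊆ᵇ V ≡ true
  ⊆ᵇ-∩ []          []         []         _ = refl , refl
  ⊆ᵇ-∩ (false ∷ R) (u ∷ U)    (v ∷ V)    R⊆U∩V = ⊆ᵇ-∩ R U V R⊆U∩V
  ⊆ᵇ-∩ (true ∷ R)  (true ∷ U) (true ∷ V) R⊆U∩V = ⊆ᵇ-∩ R U V R⊆U∩V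

  ∣x∷p∣ : ∀ {n} x (p : Subset n) → ∣ x ∷ p ∣ ≡ ⟦ x ⟧ + ∣ p ∣
  ∣x∷p∣ false p = refl
  ∣x∷p∣ true  p = refl

  ∣∪∣ : ∀ {n} (T R : Subset n) → R ⊆ᵇ ∁ T ≡ true → ∣ T ∪ R ∣ ≡ ∣ T ∣ + ∣ R ∣
  ∣∪∣ []          []          _    = refl
  ∣∪∣ (false ∷ T) (false ∷ R) R⊆∁T = ∣∪∣ T R R⊆∁T
  ∣∪∣ (false ∷ T) (true ∷ R)  R⊆∁T = trans (cong suc (∣∪∣ T R R⊆∁T)) (sym (+-suc ∣ T ∣ ∣ R ∣))
  ∣∪∣ (true ∷ T)  (false ∷ R) R⊆∁T = cong suc (∣∪∣ T R R⊆∁T)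

  ∣∁∣+∣∣ : ∀ {n} (T : Subset n) → ∣ ∁ T ∣ + ∣ T ∣ ≡ n
  ∣∁∣+∣∣ []          = refl
  ∣∁∣+∣∣ (false ∷ T) = cong suc (∣∁∣+∣∣ T)
  ∣∁∣+∣∣ (true ∷ T)  = trans (+-suc ∣ ∁ T ∣ ∣ T ∣) (cong suc (∣∁∣+∣∣ T))

  ∑ₛ : ∀ n → (Subset n → ℕ) → ℕ
  ∑ₛ zero    f = f []
  ∑ₛ (suc n) f = ∑ₛ n (λ S → f (false ∷ S)) + ∑ₛ n (λ S → f (true ∷ S))

  ∑ₛ-cong : ∀ n {f g : Subset n → ℕ} → (∀ S → f S ≡ g S) → ∑ₛ n f ≡ ∑ₛ n g
  ∑ₛ-cong zero    f≗g = f≗g []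
  ∑ₛ-cong (suc n) f≗g = cong₂ _+_ (∑ₛ-cong n (λ S → f≗g (false ∷ S))) (∑ₛ-cong n (λ S → f≗g (true ∷ S)))

  ∑ₛ-mono : ∀ n {f g : Subset n → ℕ} → (∀ S → f S ≤ g S) → ∑ₛ n f ≤ ∑ₛ n g
  ∑ₛ-mono zero    f≤g = f≤g []
  ∑ₛ-mono (suc n) f≤g = +-mono-≤ (∑ₛ-mono n (λ S → f≤g (false ∷ S))) (∑ₛ-mono n (λ S → f≤g (true ∷ S)))

  ∑ₛ-zero : ∀ n → ∑ₛ n (λ _ → 0) ≡ 0
  ∑ₛ-zero zero    = refl
  ∑ₛ-zero (suc n) = cong₂ _+_ (∑ₛ-zero n) (∑ₛ-zero n)

  ∑ₛ-distrib-+ : ∀ n (f g : Subset n → ℕ) → ∑ₛ n (λ S → f S + g S) ≡ ∑ₛ n f + ∑ₛ n g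
  ∑ₛ-distrib-+ zero    f g = refl
  ∑ₛ-distrib-+ (suc n) f g = trans
    (cong₂ _+_ (∑ₛ-distrib-+ n _ _) (∑ₛ-distrib-+ n _ _))
    (interchange (∑ₛ n (λ S → f (false ∷ S))) _ _ _)

  *-distribˡ-∑ₛ : ∀ n c (f : Subset n → ℕ) → c * ∑ₛ n f ≡ ∑ₛ n (λ S → c * f S)
  *-distribˡ-∑ₛ zero    c f = refl
  *-distribˡ-∑ₛ (suc n) c f = trans (*-distribˡ-+ c _ _) (cong₂ _+_ (*-distribˡ-∑ₛ n c _) (*-distribˡ-∑ₛ n c _))

  ∑ₛ-comm : ∀ n (f : Subset n → Subset n → ℕ) → ∑ₛ n (λ T → ∑ₛ n (f T)) ≡ ∑ₛ n (λ S → ∑ₛ n (λ T → f T S))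
  ∑ₛ-comm zero    f = refl
  ∑ₛ-comm (suc n) f = begin
    ∑ₛ (suc n) (λ T → ∑ₛ (suc n) (f T))       ≡⟨ cong₂ _+_ (∑ₛ-distrib-+ n _ _) (∑ₛ-distrib-+ n _ _) ⟩
    (ΣΣ f₀ + ΣΣ f₁) + (ΣΣ f₂ + ΣΣ f₃)         ≡⟨ interchange (ΣΣ f₀) (ΣΣ f₁) (ΣΣ f₂) (ΣΣ f₃) ⟩
    (ΣΣ f₀ + ΣΣ f₂) + (ΣΣ f₁ + ΣΣ f₃)         ≡⟨ cong₂ _+_ (cong₂ _+_ (∑ₛ-comm n f₀) (∑ₛ-comm n f₂))
                                                           (cong₂ _+_ (∑ₛ-comm n f₁) (∑ₛ-comm n f₃)) ⟩
    (ΣΣᵀ f₀ + ΣΣᵀ f₂) + (ΣΣᵀ f₁ + ΣΣᵀ f₃)     ≡⟨ sym (cong₂ _+_ (∑ₛ-distrib-+ n _ _) (∑ₛ-distrib-+ n _ _)) ⟩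
    ∑ₛ (suc n) (λ S → ∑ₛ (suc n) (λ T → f T S)) ∎
    where
    open ≡-Reasoning
    ΣΣ ΣΣᵀ : (Subset n → Subset n → ℕ) → ℕ
    ΣΣ  g = ∑ₛ n (λ T → ∑ₛ n (g T))
    ΣΣᵀ g = ∑ₛ n (λ S → ∑ₛ n (λ T → g T S))
    f₀ f₁ f₂ f₃ : Subset n → Subset n → ℕ
    f₀ T S = f (false ∷ T) (false ∷ S)
    f₁ T S = f (false ∷ T) (true ∷ S)
    f₂ T S = f (true ∷ T) (false ∷ S)
    f₃ T S = f (true ∷ T) (true ∷ S)

  ∑ₛ-size : ∀ n k → ∑ₛ n (λ S → ⟦ ∣ S ∣ ≡ᵇ k ⟧) ≡ n C k
  ∑ₛ-size zero    zero    = refl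
  ∑ₛ-size zero    (suc k) = refl
  ∑ₛ-size (suc n) zero    = cong₂ _+_ (∑ₛ-size n zero) (∑ₛ-zero n)
  ∑ₛ-size (suc n) (suc k) = trans (cong₂ _+_ (∑ₛ-size n (suc k)) (∑ₛ-size n k)) (sym (pascal n k))

  ∑ₛ-size-* : ∀ n k c → ∑ₛ n (λ S → ⟦ ∣ S ∣ ≡ᵇ k ⟧ * c) ≡ c * (n C k)
  ∑ₛ-size-* n k c =
    trans (∑ₛ-cong n (λ S → *-comm ⟦ ∣ S ∣ ≡ᵇ k ⟧ c)) (trans (sym (*-distribˡ-∑ₛ n c _)) (cong (c *_) (∑ₛ-size n k)))

  ∑ₛ-size-⊆ : ∀ {n} (U : Subset n) k → ∑ₛ n (λ R → ⟦ ∣ R ∣ ≡ᵇ k ⟧ * ⟦ R ⊆ᵇ U ⟧) ≡ ∣ U ∣ C k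
  ∑ₛ-size-⊆ []          zero    = refl
  ∑ₛ-size-⊆ []          (suc k) = refl
  ∑ₛ-size-⊆ {suc n} (false ∷ U) k = trans
    (cong₂ _+_ (∑ₛ-size-⊆ U k) (trans (∑ₛ-cong n (λ R → *-zeroʳ ⟦ suc ∣ R ∣ ≡ᵇ k ⟧)) (∑ₛ-zero n)))
    (+-identityʳ _)
  ∑ₛ-size-⊆ {suc n} (true ∷ U) zero    = cong₂ _+_ (∑ₛ-size-⊆ U zero) (∑ₛ-zero n)
  ∑ₛ-size-⊆ {suc n} (true ∷ U) (suc k) =
    trans (cong₂ _+_ (∑ₛ-size-⊆ U (suc k)) (∑ₛ-size-⊆ U k)) (sym (pascal ∣ U ∣ k))

  ∑ₛ-⊆∁-∪ : ∀ {n} (T : Subset n) (f : Subset n → ℕ) →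
    ∑ₛ n (λ R → ⟦ R ⊆ᵇ ∁ T ⟧ * f (T ∪ R)) ≡ ∑ₛ n (λ S → ⟦ T ⊆ᵇ S ⟧ * f S)
  ∑ₛ-⊆∁-∪ []          f = refl
  ∑ₛ-⊆∁-∪ (false ∷ T) f =
    cong₂ _+_ (∑ₛ-⊆∁-∪ T (λ S → f (false ∷ S))) (∑ₛ-⊆∁-∪ T (λ S → f (true ∷ S)))
  ∑ₛ-⊆∁-∪ {suc n} (true ∷ T) f = begin
    ∑ₛ n (λ R → ⟦ R ⊆ᵇ ∁ T ⟧ * f (true ∷ T ∪ R)) + ∑ₛ n (λ _ → 0)
      ≡⟨ cong₂ _+_ (∑ₛ-⊆∁-∪ T (λ S → f (true ∷ S))) (∑ₛ-zero n) ⟩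
    ∑ₛ n (λ S → ⟦ T ⊆ᵇ S ⟧ * f (true ∷ S)) + 0
      ≡⟨ +-comm _ 0 ⟩
    0 + ∑ₛ n (λ S → ⟦ T ⊆ᵇ S ⟧ * f (true ∷ S))
      ≡⟨ cong (_+ ∑ₛ n (λ S → ⟦ T ⊆ᵇ S ⟧ * f (true ∷ S))) (sym (∑ₛ-zero n)) ⟩
    ∑ₛ n (λ _ → 0) + ∑ₛ n (λ S → ⟦ T ⊆ᵇ S ⟧ * f (true ∷ S)) ∎
    where open ≡-Reasoning

  ∑ₛ-supersets : ∀ n e k (g : Subset n → ℕ) →
    ∑ₛ n (λ T → ⟦ ∣ T ∣ ≡ᵇ e ⟧ * ∑ₛ n (λ S → ⟦ T ⊆ᵇ S ⟧ * (⟦ ∣ S ∣ ≡ᵇ k ⟧ * g S)))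
      ≡ (k C e) * ∑ₛ n (λ S → ⟦ ∣ S ∣ ≡ᵇ k ⟧ * g S)
  ∑ₛ-supersets n e k g = begin
    ∑ₛ n (λ T → ⟦ ∣ T ∣ ≡ᵇ e ⟧ * ∑ₛ n (λ S → ⟦ T ⊆ᵇ S ⟧ * h S))
      ≡⟨ ∑ₛ-cong n (λ T → *-distribˡ-∑ₛ n ⟦ ∣ T ∣ ≡ᵇ e ⟧ _) ⟩
    ∑ₛ n (λ T → ∑ₛ n (λ S → ⟦ ∣ T ∣ ≡ᵇ e ⟧ * (⟦ T ⊆ᵇ S ⟧ * h S)))
      ≡⟨ ∑ₛ-comm n _ ⟩
    ∑ₛ n (λ S → ∑ₛ n (λ T → ⟦ ∣ T ∣ ≡ᵇ e ⟧ * (⟦ T ⊆ᵇ S ⟧ * h S)))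
      ≡⟨ ∑ₛ-cong n (λ S → ∑ₛ-cong n (λ T → reorder ⟦ ∣ T ∣ ≡ᵇ e ⟧ ⟦ T ⊆ᵇ S ⟧ (h S))) ⟩
    ∑ₛ n (λ S → ∑ₛ n (λ T → h S * (⟦ ∣ T ∣ ≡ᵇ e ⟧ * ⟦ T ⊆ᵇ S ⟧)))
      ≡⟨ ∑ₛ-cong n (λ S → sym (*-distribˡ-∑ₛ n (h S) _)) ⟩
    ∑ₛ n (λ S → h S * ∑ₛ n (λ T → ⟦ ∣ T ∣ ≡ᵇ e ⟧ * ⟦ T ⊆ᵇ S ⟧))
      ≡⟨ ∑ₛ-cong n (λ S → cong (h S *_) (∑ₛ-size-⊆ S e)) ⟩
    ∑ₛ n (λ S → h S * (∣ S ∣ C e))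
      ≡⟨ ∑ₛ-cong n only-size-k ⟩
    ∑ₛ n (λ S → (k C e) * h S)
      ≡⟨ sym (*-distribˡ-∑ₛ n (k C e) h) ⟩
    (k C e) * ∑ₛ n h ∎
    where
    open ≡-Reasoning
    h : Subset n → ℕ
    h S = ⟦ ∣ S ∣ ≡ᵇ k ⟧ * g S
    reorder : ∀ a b c → a * (b * c) ≡ c * (a * b)
    reorder a b c = trans (sym (*-assoc a b c)) (*-comm (a * b) c)
    only-size-k : ∀ S → h S * (∣ S ∣ C e) ≡ (k C e) * h S
    only-size-k S with ∣ S ∣ ≡ᵇ k in eq
    ... | false = sym (*-zeroʳ (k C e))
    ... | true  rewrite ≡ᵇ-true⇒≡ {∣ S ∣} {k} eq = *-comm (g S + 0) (k C e)

module FiberCount where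

  open import Data.Bool.Base using (Bool; true; false; _∧_)
  open import Data.Nat.Base using (ℕ; zero; suc; _+_; _*_; _≡ᵇ_; _≤_; z≤n; s≤s)
  open import Data.Nat.Properties hiding (_≟_)
  open import Data.Nat.Combinatorics using (_C_)
  open import Data.Nat.Tactic.RingSolver using (solve-∀)
  open import Data.Fin.Base as Fin using (Fin)
  open import Data.Fin.Properties using (_≟_)
  open import Data.Fin.Subset using (Subset; ∣_∣; _∪_; _∩_; ∁)
  open import Data.Vec.Base using (Vec; []; _∷_; map)
  open import Data.Product.Base using (proj₂)
  open import Relation.Nullary using (does)
  open import Relation.Binary.PropositionalEquality
  open import Algebra.Properties.Semiring.Sum +-*-semiring
    using (sum-syntax; sum-cong-≗; ∑-distrib-+; sum-replicate-zero; *-distribˡ-sum)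
  open Binomial using (n²≡2[nC2]+n)
  open SubsetSum

  ∑-mono : ∀ {B} {f g : Fin B → ℕ} → (∀ b → f b ≤ g b) → ∑[ b < B ] f b ≤ ∑[ b < B ] g b
  ∑-mono {zero}  f≤g = z≤n
  ∑-mono {suc B} f≤g = +-mono-≤ (f≤g _) (∑-mono (λ b → f≤g (Fin.suc b)))

  2ab≤a²+b² : ∀ a b → 2 * (a * b) ≤ a * a + b * b
  2ab≤a²+b² zero    b       = z≤n
  2ab≤a²+b² (suc a) zero    = ≤-trans (≤-reflexive (cong (2 *_) (*-zeroʳ (suc a)))) z≤n
  2ab≤a²+b² (suc a) (suc b) = subst₂ _≤_ (lhs a b) (rhs a b) (+-monoˡ-≤ (2 * a + 2 * b + 2) (2ab≤a²+b² a b))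
    where
    lhs : ∀ a b → 2 * (a * b) + (2 * a + 2 * b + 2) ≡ 2 * (suc a * suc b)
    lhs = solve-∀
    rhs : ∀ a b → a * a + b * b + (2 * a + 2 * b + 2) ≡ suc a * suc a + suc b * suc b
    rhs = solve-∀

  2aS≤Q+Ba² : ∀ B a S Q → S * S ≤ B * Q → 2 * (a * S) ≤ Q + B * (a * a)
  2aS≤Q+Ba² zero    a zero    Q _ = ≤-trans (≤-reflexive (cong (2 *_) (*-zeroʳ a))) z≤n
  2aS≤Q+Ba² (suc B) a S       Q S²≤BQ = *-cancelˡ-≤ (suc B) (begin
    suc B * (2 * (a * S))                 ≡⟨ reorder B a S ⟩
    2 * (S * (suc B * a))                 ≤⟨ 2ab≤a²+b² S (suc B * a) ⟩
    S * S + suc B * a * (suc B * a)       ≤⟨ +-monoˡ-≤ (suc B * a * (suc B * a)) S²≤BQ ⟩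
    suc B * Q + suc B * a * (suc B * a)   ≡⟨ factor B a Q ⟩
    suc B * (Q + suc B * (a * a))         ∎)
    where
    open ≤-Reasoning
    reorder : ∀ B a S → suc B * (2 * (a * S)) ≡ 2 * (S * (suc B * a))
    reorder = solve-∀
    factor : ∀ B a Q → suc B * Q + suc B * a * (suc B * a) ≡ suc B * (Q + suc B * (a * a))
    factor = solve-∀

  cauchy-schwarz : ∀ B (f : Fin B → ℕ) → (∑[ b < B ] f b) * (∑[ b < B ] f b) ≤ B * ∑[ b < B ] (f b * f b)
  cauchy-schwarz zero    f = z≤n
  cauchy-schwarz (suc B) f = begin
    (a + S) * (a + S)                   ≡⟨ expand a S ⟩
    a * a + 2 * (a * S) + S * S         ≤⟨ +-mono-≤ (+-monoʳ-≤ (a * a) (2aS≤Q+Ba² B a S Q ih)) ih ⟩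
    a * a + (Q + B * (a * a)) + B * Q   ≡⟨ collect a B Q ⟩
    suc B * (a * a + Q)                 ∎
    where
    open ≤-Reasoning
    a = f Fin.zero
    S = ∑[ b < B ] f (Fin.suc b)
    Q = ∑[ b < B ] (f (Fin.suc b) * f (Fin.suc b))
    ih : S * S ≤ B * Q
    ih = cauchy-schwarz B (λ b → f (Fin.suc b))
    expand : ∀ a S → (a + S) * (a + S) ≡ a * a + 2 * (a * S) + S * S
    expand = solve-∀
    collect : ∀ a B Q → a * a + (Q + B * (a * a)) + B * Q ≡ suc B * (a * a + Q)
    collect = solve-∀

  ∑-⟦⟧≤ : ∀ {B} (p : Fin B → Bool) {x} → ∑[ b < B ] ⟦ p b ⟧ ≤ 1 → (∀ b → p b ≡ true → 1 ≤ x) →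
    ∑[ b < B ] ⟦ p b ⟧ ≤ x
  ∑-⟦⟧≤ {zero}  p ∑≤1 1≤x = z≤n
  ∑-⟦⟧≤ {suc B} p ∑≤1 1≤x with p Fin.zero in eq
  ... | true  = ≤-trans ∑≤1 (1≤x Fin.zero eq)
  ... | false = ∑-⟦⟧≤ (λ b → p (Fin.suc b)) ∑≤1 (λ b → 1≤x (Fin.suc b))

  ∑ₛ-∑-comm : ∀ n {B} (f : Subset n → Fin B → ℕ) → ∑ₛ n (λ S → ∑[ b < B ] f S b) ≡ ∑[ b < B ] ∑ₛ n (λ S → f S b)
  ∑ₛ-∑-comm zero    f = refl
  ∑ₛ-∑-comm (suc n) {B} f = trans
    (cong₂ _+_ (∑ₛ-∑-comm n (λ S → f (false ∷ S))) (∑ₛ-∑-comm n (λ S → f (true ∷ S))))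
    (sym (∑-distrib-+ {B} (λ b → ∑ₛ n (λ S → f (false ∷ S) b)) (λ b → ∑ₛ n (λ S → f (true ∷ S) b))))

  fiber : ∀ {B n} → Vec (Fin B) n → Fin B → Subset n
  fiber ys b = map (λ y → does (y ≟ b)) ys

  ∑-⟦≟∧⟧ : ∀ {B} (y : Fin B) x → ∑[ b < B ] ⟦ does (y ≟ b) ∧ x ⟧ ≡ ⟦ x ⟧
  ∑-⟦≟∧⟧ {suc B} Fin.zero    x = trans (cong (⟦ x ⟧ +_) (sum-replicate-zero B)) (+-identityʳ ⟦ x ⟧)
  ∑-⟦≟∧⟧ {suc B} (Fin.suc y) x = ∑-⟦≟∧⟧ y x

  ∑-∣fiber∩∣ : ∀ {B n} (ys : Vec (Fin B) n) (U : Subset n) → ∑[ b < B ] ∣ fiber ys b ∩ U ∣ ≡ ∣ U ∣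
  ∑-∣fiber∩∣ {B} []       []      = sum-replicate-zero B
  ∑-∣fiber∩∣ {B} (y ∷ ys) (u ∷ U) = begin
    ∑[ b < B ] ∣ (does (y ≟ b) ∧ u) ∷ fiber ys b ∩ U ∣
      ≡⟨ sum-cong-≗ {B} (λ b → ∣x∷p∣ (does (y ≟ b) ∧ u) (fiber ys b ∩ U)) ⟩
    ∑[ b < B ] (⟦ does (y ≟ b) ∧ u ⟧ + ∣ fiber ys b ∩ U ∣)
      ≡⟨ ∑-distrib-+ {B} (λ b → ⟦ does (y ≟ b) ∧ u ⟧) (λ b → ∣ fiber ys b ∩ U ∣) ⟩
    ∑[ b < B ] ⟦ does (y ≟ b) ∧ u ⟧ + ∑[ b < B ] ∣ fiber ys b ∩ U ∣
      ≡⟨ cong₂ _+_ (∑-⟦≟∧⟧ y u) (∑-∣fiber∩∣ ys U) ⟩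
    ⟦ u ⟧ + ∣ U ∣
      ≡⟨ sym (∣x∷p∣ u U) ⟩
    ∣ u ∷ U ∣ ∎
    where
    open ≡-Reasoning

  ∑-⟦⊆ᵇfiber∩⟧≤1 : ∀ {B n} (ys : Vec (Fin B) n) U (R : Subset n) → 1 ≤ ∣ R ∣ →
    ∑[ b < B ] ⟦ R ⊆ᵇ fiber ys b ∩ U ⟧ ≤ 1
  ∑-⟦⊆ᵇfiber∩⟧≤1 (y ∷ ys) (u ∷ U) (false ∷ R) 1≤∣R∣ = ∑-⟦⊆ᵇfiber∩⟧≤1 ys U R 1≤∣R∣
  ∑-⟦⊆ᵇfiber∩⟧≤1 {B} (y ∷ ys) (u ∷ U) (true ∷ R) _ =
    ≤-trans (∑-mono (λ b → only-b≡y (does (y ≟ b)))) (≤-reflexive (∑-⟦≟∧⟧ y true))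
    where
    only-b≡y : ∀ d {x} → ⟦ (d ∧ u) ∧ x ⟧ ≤ ⟦ d ∧ true ⟧
    only-b≡y false = z≤n
    only-b≡y true  = ⟦⟧≤1 (u ∧ _)

  extensions : ∀ {n} → (Subset n → Bool) → ℕ → Subset n → ℕ
  extensions {n} Q k T = ∑ₛ n (λ S → ⟦ T ⊆ᵇ S ⟧ * (⟦ ∣ S ∣ ≡ᵇ k ⟧ * ⟦ Q S ⟧))

  ExtendsAlongFibers : ∀ {B n} → (Subset n → Bool) → Subset n → Vec (Fin B) n → Set
  ExtendsAlongFibers {B} {n} Q T ys = ∀ b (R : Subset n) → R ⊆ᵇ fiber ys b ∩ ∁ T ≡ true → Q (T ∪ R) ≡ true

  ∑-pairs≤extensions : ∀ {B n} (T : Subset n) (ys : Vec (Fin B) n) (Q : Subset n → Bool) →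
    ExtendsAlongFibers Q T ys → ∑[ b < B ] (∣ fiber ys b ∩ ∁ T ∣ C 2) ≤ extensions Q (∣ T ∣ + 2) T
  ∑-pairs≤extensions {B} {n} T ys Q extends = begin
    ∑[ b < B ] (∣ U b ∣ C 2)
      ≡⟨ sum-cong-≗ {B} (λ b → sym (∑ₛ-size-⊆ (U b) 2)) ⟩
    ∑[ b < B ] ∑ₛ n (λ R → ⟦ ∣ R ∣ ≡ᵇ 2 ⟧ * ⟦ R ⊆ᵇ U b ⟧)
      ≡⟨ sym (∑ₛ-∑-comm n {B} _) ⟩
    ∑ₛ n (λ R → ∑[ b < B ] (⟦ ∣ R ∣ ≡ᵇ 2 ⟧ * ⟦ R ⊆ᵇ U b ⟧))
      ≡⟨ ∑ₛ-cong n (λ R → sym (*-distribˡ-sum ⟦ ∣ R ∣ ≡ᵇ 2 ⟧ (λ b → ⟦ R ⊆ᵇ U b ⟧))) ⟩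
    ∑ₛ n (λ R → ⟦ ∣ R ∣ ≡ᵇ 2 ⟧ * ∑[ b < B ] ⟦ R ⊆ᵇ U b ⟧)
      ≤⟨ ∑ₛ-mono n pair-≤ ⟩
    ∑ₛ n (λ R → ⟦ R ⊆ᵇ ∁ T ⟧ * f (T ∪ R))
      ≡⟨ ∑ₛ-⊆∁-∪ T f ⟩
    extensions Q (∣ T ∣ + 2) T ∎
    where
    open ≤-Reasoning
    U : Fin B → Subset n
    U b = fiber ys b ∩ ∁ T
    f : Subset n → ℕ
    f S = ⟦ ∣ S ∣ ≡ᵇ ∣ T ∣ + 2 ⟧ * ⟦ Q S ⟧
    pair-≤ : ∀ R → ⟦ ∣ R ∣ ≡ᵇ 2 ⟧ * ∑[ b < B ] ⟦ R ⊆ᵇ U b ⟧ ≤ ⟦ R ⊆ᵇ ∁ T ⟧ * f (T ∪ R)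
    pair-≤ R with ∣ R ∣ ≡ᵇ 2 in ∣R∣≡ᵇ2
    ... | false = z≤n
    ... | true  = ≤-trans (≤-reflexive (+-identityʳ _))
                    (∑-⟦⟧≤ (λ b → R ⊆ᵇ U b) (∑-⟦⊆ᵇfiber∩⟧≤1 ys (∁ T) R (subst (1 ≤_) (sym ∣R∣≡2) (s≤s z≤n))) good)
      where
      ∣R∣≡2 : ∣ R ∣ ≡ 2
      ∣R∣≡2 = ≡ᵇ-true⇒≡ ∣R∣≡ᵇ2
      good : ∀ b → R ⊆ᵇ U b ≡ true → 1 ≤ ⟦ R ⊆ᵇ ∁ T ⟧ * f (T ∪ R)
      good b R⊆U = *-mono-≤ (1≤⟦⟧ R⊆∁T) (*-mono-≤ (1≤⟦≡ᵇ⟧ ∣T∪R∣≡∣T∣+2) (1≤⟦⟧ (extends b R R⊆U)))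
        where
        R⊆∁T = proj₂ (⊆ᵇ-∩ R (fiber ys b) (∁ T) R⊆U)
        ∣T∪R∣≡∣T∣+2 : ∣ T ∪ R ∣ ≡ ∣ T ∣ + 2
        ∣T∪R∣≡∣T∣+2 = trans (∣∪∣ T R R⊆∁T) (cong (∣ T ∣ +_) ∣R∣≡2)

  ∣∁T∣²≤extensions : ∀ {B n} (T : Subset n) (ys : Vec (Fin B) n) (Q : Subset n → Bool) →
    ExtendsAlongFibers Q T ys → ∣ ∁ T ∣ * ∣ ∁ T ∣ ≤ B * (2 * extensions Q (∣ T ∣ + 2) T + ∣ ∁ T ∣)
  ∣∁T∣²≤extensions {B} T ys Q extends = begin
    M * M
      ≡⟨ cong (λ x → x * x) (sym (∑-∣fiber∩∣ ys (∁ T))) ⟩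
    (∑[ b < B ] m b) * (∑[ b < B ] m b)
      ≤⟨ cauchy-schwarz B m ⟩
    B * ∑[ b < B ] (m b * m b)
      ≡⟨ cong (B *_) ∑m² ⟩
    B * (2 * ∑[ b < B ] (m b C 2) + M)
      ≤⟨ *-monoʳ-≤ B (+-monoˡ-≤ M (*-monoʳ-≤ 2 (∑-pairs≤extensions T ys Q extends))) ⟩
    B * (2 * extensions Q (∣ T ∣ + 2) T + M) ∎
    where
    open ≤-Reasoning
    M = ∣ ∁ T ∣
    m : Fin B → ℕ
    m b = ∣ fiber ys b ∩ ∁ T ∣
    ∑m² : ∑[ b < B ] (m b * m b) ≡ 2 * ∑[ b < B ] (m b C 2) + M
    ∑m² = begin-equality
      ∑[ b < B ] (m b * m b)
        ≡⟨ sum-cong-≗ {B} (λ b → n²≡2[nC2]+n (m b)) ⟩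
      ∑[ b < B ] (2 * (m b C 2) + m b)
        ≡⟨ ∑-distrib-+ {B} (λ b → 2 * (m b C 2)) m ⟩
      ∑[ b < B ] (2 * (m b C 2)) + ∑[ b < B ] m b
        ≡⟨ cong₂ _+_ (sym (*-distribˡ-sum 2 (λ b → m b C 2))) (∑-∣fiber∩∣ ys (∁ T)) ⟩
      2 * ∑[ b < B ] (m b C 2) + M ∎

module Selection {A : Set} where

  open import Data.Bool.Base using (true; false)
  open import Data.Nat.Base using (ℕ; zero; suc; _+_; _*_; _≡ᵇ_)
  open import Data.Nat.Properties using (+-identityʳ; +-comm)
  open import Data.Fin.Base using (Fin)
  open import Data.Fin.Properties using (_≟_)
  open import Data.Fin.Subset using (Subset; ∣_∣; _∪_)
  open import Data.Vec.Base using (Vec; []; _∷_; fromList)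
  import Data.Vec.Base as Vec
  open import Data.List.Base as List using (List; []; _∷_; length; filter; _++_)
  open import Data.List.Properties using (filter-++; length-++)
  open import Data.List.Relation.Unary.All using (All; []; _∷_)
  open import Level using (0ℓ)
  open import Relation.Nullary using (does; yes)
  open import Relation.Unary using (Pred; Decidable)
  open import Relation.Binary.PropositionalEquality
  open SubsetSum using (⟦_⟧; _⊆ᵇ_; ∑ₛ; ∑ₛ-zero)
  open FiberCount using (fiber)

  select : ∀ {n} → Subset n → Vec A n → List A
  select []          []       = []
  select (true ∷ S)  (x ∷ xs) = x ∷ select S xs
  select (false ∷ S) (x ∷ xs) = select S xs

  length-select : ∀ {n} (S : Subset n) (xs : Vec A n) → length (select S xs) ≡ ∣ S ∣
  length-select []          []       = refl
  length-select (true ∷ S)  (x ∷ xs) = cong suc (length-select S xs)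
  length-select (false ∷ S) (x ∷ xs) = length-select S xs

  select-∪ : ∀ {n} {P : A → Set} (T R : Subset n) (xs : Vec A n) →
    All P (select T xs) → All P (select R xs) → All P (select (T ∪ R) xs)
  select-∪ []          []          []       _          _          = []
  select-∪ (false ∷ T) (false ∷ R) (x ∷ xs) pT         pR         = select-∪ T R xs pT pR
  select-∪ (false ∷ T) (true ∷ R)  (x ∷ xs) pT         (px ∷ pR)  = px ∷ select-∪ T R xs pT pR
  select-∪ (true ∷ T)  (false ∷ R) (x ∷ xs) (px ∷ pT)  pR         = px ∷ select-∪ T R xs pT pR
  select-∪ (true ∷ T)  (true ∷ R)  (x ∷ xs) (px ∷ pT)  (_ ∷ pR)   = px ∷ select-∪ T R xs pT pR

  select-⊆ᵇfiber : ∀ {n B} (f : A → Fin B) b (R : Subset n) (xs : Vec A n) →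
    R ⊆ᵇ fiber (Vec.map f xs) b ≡ true → All (λ x → f x ≡ b) (select R xs)
  select-⊆ᵇfiber f b []          []       _    = []
  select-⊆ᵇfiber f b (false ∷ R) (x ∷ xs) R⊆fb = select-⊆ᵇfiber f b R xs R⊆fb
  select-⊆ᵇfiber f b (true ∷ R)  (x ∷ xs) R⊆fb with f x ≟ b
  ... | yes fx≡b = fx≡b ∷ select-⊆ᵇfiber f b R xs R⊆fb

  length-filter-map : ∀ {P : Pred (List A) 0ℓ} (P? : Decidable P) (f : List A → List A) xss →
    length (filter P? (List.map f xss)) ≡ length (filter (λ xs → P? (f xs)) xss)
  length-filter-map P? f []         = refl
  length-filter-map P? f (xs ∷ xss) with does (P? (f xs))
  ... | true  = cong suc (length-filter-map P? f xss)
  ... | false = length-filter-map P? f xss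

  ∑ₛ-size-0 : ∀ {n} (xs : Vec A n) (g : List A → ℕ) → ∑ₛ n (λ S → ⟦ ∣ S ∣ ≡ᵇ 0 ⟧ * g (select S xs)) ≡ g []
  ∑ₛ-size-0 [] g = +-identityʳ (g [])
  ∑ₛ-size-0 {suc n} (x ∷ xs) g = trans (cong₂ _+_ (∑ₛ-size-0 xs g) (∑ₛ-zero n)) (+-identityʳ (g []))

  length-filter-combinations : ∀ {P : Pred (List A) 0ℓ} (P? : Decidable P) k xs →
    length (filter P? (combinations k xs)) ≡ ∑ₛ (length xs) (λ S → ⟦ ∣ S ∣ ≡ᵇ k ⟧ * ⟦ does (P? (select S (fromList xs))) ⟧)
  length-filter-combinations P? zero xs =
    trans singleton (sym (∑ₛ-size-0 (fromList xs) (λ ys → ⟦ does (P? ys) ⟧)))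
    where
    singleton : length (filter P? ([] ∷ [])) ≡ ⟦ does (P? []) ⟧
    singleton with does (P? [])
    ... | true  = refl
    ... | false = refl
  length-filter-combinations P? (suc k) []       = refl
  length-filter-combinations P? (suc k) (x ∷ xs) = begin
    length (filter P? (List.map (x ∷_) (combinations k xs) ++ combinations (suc k) xs))
      ≡⟨ cong length (filter-++ P? (List.map (x ∷_) (combinations k xs)) _) ⟩
    length (filter P? (List.map (x ∷_) (combinations k xs)) ++ filter P? (combinations (suc k) xs))
      ≡⟨ length-++ (filter P? (List.map (x ∷_) (combinations k xs))) ⟩
    length (filter P? (List.map (x ∷_) (combinations k xs))) + length (filter P? (combinations (suc k) xs))
      ≡⟨ cong₂ _+_ (trans (length-filter-map P? (x ∷_) (combinations k xs))
                          (length-filter-combinations (λ ys → P? (x ∷ ys)) k xs))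
                   (length-filter-combinations P? (suc k) xs) ⟩
    ∑ₛ (length xs) (λ S → ⟦ ∣ S ∣ ≡ᵇ k ⟧ * ⟦ does (P? (x ∷ select S (fromList xs))) ⟧)
      + ∑ₛ (length xs) (λ S → ⟦ ∣ S ∣ ≡ᵇ suc k ⟧ * ⟦ does (P? (select S (fromList xs))) ⟧)
      ≡⟨ +-comm (∑ₛ (length xs) (λ S → ⟦ ∣ S ∣ ≡ᵇ k ⟧ * ⟦ does (P? (x ∷ select S (fromList xs))) ⟧)) _ ⟩
    _ ∎
    where open ≡-Reasoning

module LinearAlgebra {q : ℕ} (F : FieldOn q) where

  open import Level using (0ℓ)
  open import Data.Nat.Base as ℕ using (ℕ; zero; suc)
  import Data.Nat.Properties as ℕ
  open import Data.Fin.Base as Fin using (Fin)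
  open import Data.Fin.Properties using (_≟_)
  open import Data.Vec.Base as Vec using (Vec; []; _∷_; zipWith)
  open import Data.Vec.Properties using (∷-injectiveˡ; ∷-injectiveʳ)
  open import Data.Vec.Relation.Unary.All as All using (All; []; _∷_)
  open import Data.Vec.Relation.Unary.All.Properties using (map⁺)
  open import Data.List.Base as List using (List; length)
  open import Data.List.Properties using (length-map)
  import Data.List.Relation.Unary.All as ListAll
  open import Data.List.Relation.Unary.All.Properties using (map⁻)
  open import Data.Product.Base using (Σ; ∃; _×_; _,_; proj₁)
  open import Relation.Nullary using (yes; no)
  open import Relation.Binary.PropositionalEquality
  open import Algebra.Bundles using (CommutativeRing)
  import Algebra.Properties.Ring as RingProperties
  import Algebra.Properties.CommutativeSemigroup as CommutativeSemigroupProperties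

  open FieldOn F using (0#; 1#; 0≢1; inverse; isCommutativeRing)

  commutativeRing : CommutativeRing 0ℓ 0ℓ
  commutativeRing = record { isCommutativeRing = isCommutativeRing }

  open CommutativeRing commutativeRing
    using ( _+_; _*_; -_; +-identityˡ; +-identityʳ; +-comm; *-identityˡ; *-identityʳ; *-assoc; *-comm
          ; zeroˡ; zeroʳ; distribˡ; distribʳ; -‿inverseʳ; ring
          ; +-commutativeSemigroup; *-commutativeSemigroup )
  open RingProperties ring using (-‿distribˡ-*; -‿distribʳ-*; -0#≈0#; -‿+-comm; +-inverseʳ-unique)
  open CommutativeSemigroupProperties +-commutativeSemigroup using (interchange)
  open CommutativeSemigroupProperties *-commutativeSemigroup using (x∙yz≈y∙xz)

  private variable n k : ℕ

  Vector : ℕ → Set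
  Vector = Point F

  0ᵥ : ∀ n → Vector n
  0ᵥ = zeroVec F

  infixl 6 _⊕_
  infixr 7 _⊙_
  infix 4 _⊥_

  _⊕_ : Vector n → Vector n → Vector n
  _⊕_ = zipWith _+_

  _⊙_ : Fin q → Vector n → Vector n
  s ⊙ v = Vec.map (s *_) v

  _·_ : Vector n → Vector n → Fin q
  _·_ = dot F

  _⊥_ : Vector n → Vector n → Set
  c ⊥ w = c · w ≡ 0#

  x*y≡0⇒y≡0 : ∀ {x y} → x ≢ 0# → x * y ≡ 0# → y ≡ 0#
  x*y≡0⇒y≡0 {x} {y} x≢0 xy≡0 with inverse x x≢0
  ... | x⁻¹ , xx⁻¹≡1 = begin
    y               ≡⟨ sym (*-identityˡ y) ⟩
    1# * y          ≡⟨ cong (_* y) (trans (sym xx⁻¹≡1) (*-comm x x⁻¹)) ⟩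
    x⁻¹ * x * y     ≡⟨ *-assoc x⁻¹ x y ⟩
    x⁻¹ * (x * y)   ≡⟨ cong (x⁻¹ *_) xy≡0 ⟩
    x⁻¹ * 0#        ≡⟨ zeroʳ x⁻¹ ⟩
    0#              ∎
    where open ≡-Reasoning

  -1≢0 : - 1# ≢ 0#
  -1≢0 -1≡0 = 0≢1 (sym (begin
    1#           ≡⟨ sym (+-identityʳ 1#) ⟩
    1# + 0#      ≡⟨ cong (1# +_) (sym -1≡0) ⟩
    1# + - 1#    ≡⟨ -‿inverseʳ 1# ⟩
    0#           ∎))
    where open ≡-Reasoning

  ·-⊕ : ∀ (c u v : Vector n) → c · (u ⊕ v) ≡ c · u + c · v
  ·-⊕ [] [] [] = sym (+-identityʳ 0#)
  ·-⊕ (c ∷ cs) (u ∷ us) (v ∷ vs) = begin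
    c * (u + v) + cs · (us ⊕ vs)            ≡⟨ cong₂ _+_ (distribˡ c u v) (·-⊕ cs us vs) ⟩
    (c * u + c * v) + (cs · us + cs · vs)   ≡⟨ interchange (c * u) (c * v) (cs · us) (cs · vs) ⟩
    (c * u + cs · us) + (c * v + cs · vs)   ∎
    where open ≡-Reasoning

  ·-⊙ : ∀ (c : Vector n) s u → c · (s ⊙ u) ≡ s * (c · u)
  ·-⊙ [] s [] = sym (zeroʳ s)
  ·-⊙ (c ∷ cs) s (u ∷ us) = begin
    c * (s * u) + cs · (s ⊙ us)   ≡⟨ cong₂ _+_ (x∙yz≈y∙xz c s u) (·-⊙ cs s us) ⟩
    s * (c * u) + s * (cs · us)   ≡⟨ sym (distribˡ s (c * u) (cs · us)) ⟩
    s * (c * u + cs · us)         ∎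
    where open ≡-Reasoning

  ·-0ᵥ : ∀ (c : Vector n) → c · 0ᵥ n ≡ 0#
  ·-0ᵥ [] = refl
  ·-0ᵥ (c ∷ cs) = trans (cong₂ _+_ (zeroʳ c) (·-0ᵥ cs)) (+-identityʳ 0#)

  ·-comm : ∀ (u v : Vector n) → u · v ≡ v · u
  ·-comm [] [] = refl
  ·-comm (u ∷ us) (v ∷ vs) = cong₂ _+_ (*-comm u v) (·-comm us vs)

  0⊙ : ∀ (v : Vector n) → 0# ⊙ v ≡ 0ᵥ n
  0⊙ [] = refl
  0⊙ (x ∷ v) = cong₂ _∷_ (zeroˡ x) (0⊙ v)

  0ᵥ⊕ : ∀ (v : Vector n) → 0ᵥ n ⊕ v ≡ v
  0ᵥ⊕ [] = refl
  0ᵥ⊕ (x ∷ v) = cong₂ _∷_ (+-identityˡ x) (0ᵥ⊕ v)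

  ⊙-0ᵥ-inv : ∀ {s} (v : Vector n) → s ≢ 0# → s ⊙ v ≡ 0ᵥ n → v ≡ 0ᵥ n
  ⊙-0ᵥ-inv [] s≢0 _ = refl
  ⊙-0ᵥ-inv (x ∷ v) s≢0 eq =
    cong₂ _∷_ (x*y≡0⇒y≡0 s≢0 (∷-injectiveˡ eq)) (⊙-0ᵥ-inv v s≢0 (∷-injectiveʳ eq))

  lincomb : Vec (Vector n) k → Vector k → Vector n
  lincomb []       []       = 0ᵥ _
  lincomb (v ∷ vs) (l ∷ ls) = l ⊙ v ⊕ lincomb vs ls

  Independent : Vec (Vector n) k → Set
  Independent {k = k} vs = ∀ ls → lincomb vs ls ≡ 0ᵥ _ → ls ≡ 0ᵥ k

  ⊥-lincomb : ∀ c (vs : Vec (Vector n) k) ls → All (c ⊥_) vs → c ⊥ lincomb vs ls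
  ⊥-lincomb c [] [] [] = ·-0ᵥ c
  ⊥-lincomb c (v ∷ vs) (l ∷ ls) (c⊥v ∷ c⊥vs) = begin
    c · (l ⊙ v ⊕ lincomb vs ls)          ≡⟨ ·-⊕ c (l ⊙ v) (lincomb vs ls) ⟩
    c · (l ⊙ v) + c · lincomb vs ls      ≡⟨ cong₂ _+_ (trans (·-⊙ c l v) (cong (l *_) c⊥v)) (⊥-lincomb c vs ls c⊥vs) ⟩
    l * 0# + 0#                          ≡⟨ trans (+-identityʳ _) (zeroʳ l) ⟩
    0#                                   ∎
    where open ≡-Reasoning

  eliminate : Vector n → Vector n → Vector n → Vector n
  eliminate c v w = (c · v) ⊙ w ⊕ (- (c · w)) ⊙ v

  eliminate-⊥ : ∀ c v (w : Vector n) → c ⊥ eliminate c v w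
  eliminate-⊥ c v w = begin
    c · ((c · v) ⊙ w ⊕ (- (c · w)) ⊙ v)
      ≡⟨ ·-⊕ c _ _ ⟩
    c · ((c · v) ⊙ w) + c · ((- (c · w)) ⊙ v)
      ≡⟨ cong₂ _+_ (·-⊙ c (c · v) w) (·-⊙ c (- (c · w)) v) ⟩
    (c · v) * (c · w) + - (c · w) * (c · v)
      ≡⟨ cong ((c · v) * (c · w) +_) (trans (sym (-‿distribˡ-* _ _)) (cong -_ (*-comm _ _))) ⟩
    (c · v) * (c · w) + - ((c · v) * (c · w))
      ≡⟨ -‿inverseʳ _ ⟩
    0# ∎
    where open ≡-Reasoning

  eliminate-preserves-⊥ : ∀ c c′ (v w : Vector n) → c′ ⊥ v → c′ ⊥ w → c′ ⊥ eliminate c v w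
  eliminate-preserves-⊥ c c′ v w c′⊥v c′⊥w = begin
    c′ · ((c · v) ⊙ w ⊕ (- (c · w)) ⊙ v)                ≡⟨ ·-⊕ c′ _ _ ⟩
    c′ · ((c · v) ⊙ w) + c′ · ((- (c · w)) ⊙ v)         ≡⟨ cong₂ _+_ (·-⊙ c′ (c · v) w) (·-⊙ c′ (- (c · w)) v) ⟩
    (c · v) * (c′ · w) + - (c · w) * (c′ · v)           ≡⟨ cong₂ (λ x y → (c · v) * x + - (c · w) * y) c′⊥w c′⊥v ⟩
    (c · v) * 0# + - (c · w) * 0#                       ≡⟨ cong₂ _+_ (zeroʳ _) (zeroʳ _) ⟩
    0# + 0#                                             ≡⟨ +-identityʳ 0# ⟩
    0#                                                  ∎
    where open ≡-Reasoning

  ⊙⊕-regroup : ∀ m s α β (w v x : Vector n) →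
    m ⊙ (s ⊙ w ⊕ (- α) ⊙ v) ⊕ ((- β) ⊙ v ⊕ x) ≡ (- (m * α + β)) ⊙ v ⊕ ((s * m) ⊙ w ⊕ x)
  ⊙⊕-regroup m s α β []       []       []       = refl
  ⊙⊕-regroup m s α β (w ∷ ws) (v ∷ vs) (x ∷ xs) = cong₂ _∷_ (begin
    m * (s * w + - α * v) + (- β * v + x)            ≡⟨ cong (_+ (- β * v + x)) (distribˡ m (s * w) (- α * v)) ⟩
    (m * (s * w) + m * (- α * v)) + (- β * v + x)    ≡⟨ cong₂ (λ a b → (a + b) + (- β * v + x)) m[sw] m[-αv] ⟩
    (s * m * w + - (m * α) * v) + (- β * v + x)      ≡⟨ cong (_+ (- β * v + x)) (+-comm _ _) ⟩
    (- (m * α) * v + s * m * w) + (- β * v + x)      ≡⟨ interchange (- (m * α) * v) (s * m * w) (- β * v) x ⟩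
    (- (m * α) * v + - β * v) + (s * m * w + x)      ≡⟨ cong (_+ (s * m * w + x)) -[mα]v-βv ⟩
    - (m * α + β) * v + (s * m * w + x)              ∎) (⊙⊕-regroup m s α β ws vs xs)
    where
    open ≡-Reasoning
    m[sw] : m * (s * w) ≡ s * m * w
    m[sw] = trans (sym (*-assoc m s w)) (cong (_* w) (*-comm m s))
    m[-αv] : m * (- α * v) ≡ - (m * α) * v
    m[-αv] = trans (sym (*-assoc m (- α) v)) (cong (_* v) (sym (-‿distribʳ-* m α)))
    -[mα]v-βv : - (m * α) * v + - β * v ≡ - (m * α + β) * v
    -[mα]v-βv = trans (sym (distribʳ v _ _)) (cong (_* v) (-‿+-comm (m * α) β))

  lincomb-map-eliminate : ∀ c v (ws : Vec (Vector n) k) μ →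
    lincomb (Vec.map (eliminate c v) ws) μ ≡ lincomb (v ∷ ws) (- (c · lincomb ws μ) ∷ (c · v) ⊙ μ)
  lincomb-map-eliminate c v [] [] = sym (begin
    - (c · 0ᵥ _) ⊙ v ⊕ 0ᵥ _   ≡⟨ cong (λ x → - x ⊙ v ⊕ 0ᵥ _) (·-0ᵥ c) ⟩
    - 0# ⊙ v ⊕ 0ᵥ _           ≡⟨ cong (λ x → x ⊙ v ⊕ 0ᵥ _) -0#≈0# ⟩
    0# ⊙ v ⊕ 0ᵥ _             ≡⟨ cong (_⊕ 0ᵥ _) (0⊙ v) ⟩
    0ᵥ _ ⊕ 0ᵥ _               ≡⟨ 0ᵥ⊕ (0ᵥ _) ⟩
    0ᵥ _                      ∎)
    where open ≡-Reasoning
  lincomb-map-eliminate c v (w ∷ ws) (m ∷ μ) = begin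
    m ⊙ eliminate c v w ⊕ lincomb (Vec.map (eliminate c v) ws) μ
      ≡⟨ cong (m ⊙ eliminate c v w ⊕_) (lincomb-map-eliminate c v ws μ) ⟩
    m ⊙ ((c · v) ⊙ w ⊕ (- (c · w)) ⊙ v) ⊕ (- (c · L) ⊙ v ⊕ lincomb ws ((c · v) ⊙ μ))
      ≡⟨ ⊙⊕-regroup m (c · v) (c · w) (c · L) w v _ ⟩
    - (m * (c · w) + c · L) ⊙ v ⊕ ((c · v * m) ⊙ w ⊕ lincomb ws ((c · v) ⊙ μ))
      ≡⟨ cong (λ x → - x ⊙ v ⊕ ((c · v * m) ⊙ w ⊕ lincomb ws ((c · v) ⊙ μ))) (sym c·mw⊕L) ⟩
    - (c · (m ⊙ w ⊕ L)) ⊙ v ⊕ ((c · v * m) ⊙ w ⊕ lincomb ws ((c · v) ⊙ μ))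
      ∎
    where
    open ≡-Reasoning
    L = lincomb ws μ
    c·mw⊕L : c · (m ⊙ w ⊕ L) ≡ m * (c · w) + c · L
    c·mw⊕L = trans (·-⊕ c (m ⊙ w) L) (cong (_+ c · L) (·-⊙ c m w))

  -- One step of Gaussian elimination against the linear form c.
  restrict : Vector n → Vec (Vector n) (suc k) → Vec (Vector n) k
  restrict {k = zero}  c (v ∷ []) = []
  restrict {k = suc k} c (v ∷ vs) with c · v ≟ 0#
  ... | yes _ = v ∷ restrict c vs
  ... | no  _ = Vec.map (eliminate c v) vs

  restrict-⊥ : ∀ c (vs : Vec (Vector n) (suc k)) → All (c ⊥_) (restrict c vs)
  restrict-⊥ {k = zero}  c (v ∷ []) = []
  restrict-⊥ {k = suc k} c (v ∷ vs) with c · v ≟ 0#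
  ... | yes c⊥v = c⊥v ∷ restrict-⊥ c vs
  ... | no  _   = map⁺ (All.universal (eliminate-⊥ c v) vs)

  restrict-preserves-⊥ : ∀ c c′ (vs : Vec (Vector n) (suc k)) → All (c′ ⊥_) vs → All (c′ ⊥_) (restrict c vs)
  restrict-preserves-⊥ {k = zero}  c c′ (v ∷ []) _ = []
  restrict-preserves-⊥ {k = suc k} c c′ (v ∷ vs) (c′⊥v ∷ c′⊥vs) with c · v ≟ 0#
  ... | yes _ = c′⊥v ∷ restrict-preserves-⊥ c c′ vs c′⊥vs
  ... | no  _ = map⁺ (All.map (λ {w} → eliminate-preserves-⊥ c c′ v w c′⊥v) c′⊥vs)

  restrict-lincomb : ∀ c (vs : Vec (Vector n) (suc k)) μ →
    ∃ λ ν → lincomb (restrict c vs) μ ≡ lincomb vs ν × (ν ≡ 0ᵥ _ → μ ≡ 0ᵥ k)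
  restrict-lincomb {k = zero}  c (v ∷ []) [] =
    0ᵥ 1 , sym (trans (cong (_⊕ 0ᵥ _) (0⊙ v)) (0ᵥ⊕ _)) , λ _ → refl
  restrict-lincomb {k = suc k} c (v ∷ vs) μ with c · v ≟ 0#
  restrict-lincomb {k = suc k} c (v ∷ vs) (l ∷ μ) | yes _ with restrict-lincomb c vs μ
  ... | ν , eq , ν≡0⇒μ≡0 =
    l ∷ ν , cong (l ⊙ v ⊕_) eq ,
    λ lν≡0 → cong₂ _∷_ (∷-injectiveˡ lν≡0) (ν≡0⇒μ≡0 (∷-injectiveʳ lν≡0))
  restrict-lincomb {k = suc k} c (v ∷ vs) μ | no c·v≢0 =
    _ , lincomb-map-eliminate c v vs μ , λ ν≡0 → ⊙-0ᵥ-inv μ c·v≢0 (∷-injectiveʳ ν≡0)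

  restrict-independent : ∀ c (vs : Vec (Vector n) (suc k)) → Independent vs → Independent (restrict c vs)
  restrict-independent c vs ind μ eq with restrict-lincomb c vs μ
  ... | ν , eq′ , ν≡0⇒μ≡0 = ν≡0⇒μ≡0 (ind ν (trans (sym eq′) eq))

  restrictAll : (cs : List (Vector n)) → Vec (Vector n) (length cs ℕ.+ k) → Vec (Vector n) k
  restrictAll List.[]       vs = vs
  restrictAll (c List.∷ cs) vs = restrictAll cs (restrict c vs)

  restrictAll-independent : ∀ cs (vs : Vec (Vector n) (length cs ℕ.+ k)) → Independent vs → Independent (restrictAll cs vs)
  restrictAll-independent List.[]       vs ind = ind
  restrictAll-independent (c List.∷ cs) vs ind = restrictAll-independent cs _ (restrict-independent c vs ind)

  restrictAll-preserves-⊥ : ∀ c′ cs (vs : Vec (Vector n) (length cs ℕ.+ k)) → All (c′ ⊥_) vs → All (c′ ⊥_) (restrictAll cs vs)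
  restrictAll-preserves-⊥ c′ List.[]       vs c′⊥vs = c′⊥vs
  restrictAll-preserves-⊥ c′ (c List.∷ cs) vs c′⊥vs = restrictAll-preserves-⊥ c′ cs _ (restrict-preserves-⊥ c c′ vs c′⊥vs)

  restrictAll-⊥ : ∀ cs (vs : Vec (Vector n) (length cs ℕ.+ k)) → ListAll.All (λ c → All (c ⊥_) (restrictAll cs vs)) cs
  restrictAll-⊥ List.[]       vs = ListAll.[]
  restrictAll-⊥ (c List.∷ cs) vs =
    restrictAll-preserves-⊥ c cs _ (restrict-⊥ c vs) ListAll.∷ restrictAll-⊥ cs (restrict c vs)

  basis : ∀ n → Vec (Vector n) n
  basis zero    = []
  basis (suc n) = (1# ∷ 0ᵥ n) ∷ Vec.map (0# ∷_) (basis n)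

  lincomb-basis : ∀ n (ls : Vector n) → lincomb (basis n) ls ≡ ls
  lincomb-basis zero    []       = refl
  lincomb-basis (suc n) (l ∷ ls) = begin
    l ⊙ (1# ∷ 0ᵥ n) ⊕ lincomb (Vec.map (0# ∷_) (basis n)) ls
      ≡⟨ cong (l ⊙ (1# ∷ 0ᵥ n) ⊕_) (lincomb-shift (basis n) ls) ⟩
    (l * 1# + 0#) ∷ (l ⊙ 0ᵥ n ⊕ lincomb (basis n) ls)
      ≡⟨ cong₂ _∷_ (trans (+-identityʳ _) (*-identityʳ l)) (cong (_⊕ lincomb (basis n) ls) (⊙0ᵥ l)) ⟩
    l ∷ (0ᵥ n ⊕ lincomb (basis n) ls)
      ≡⟨ cong (l ∷_) (trans (0ᵥ⊕ _) (lincomb-basis n ls)) ⟩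
    l ∷ ls ∎
    where
    open ≡-Reasoning
    ⊙0ᵥ : ∀ {m} s → s ⊙ 0ᵥ m ≡ 0ᵥ m
    ⊙0ᵥ {zero}  s = refl
    ⊙0ᵥ {suc m} s = cong₂ _∷_ (zeroʳ s) (⊙0ᵥ s)
    lincomb-shift : ∀ {m j} (vs : Vec (Vector m) j) μ → lincomb (Vec.map (0# ∷_) vs) μ ≡ 0# ∷ lincomb vs μ
    lincomb-shift []       []      = refl
    lincomb-shift (v ∷ vs) (m ∷ μ) =
      trans (cong (m ⊙ (0# ∷ v) ⊕_) (lincomb-shift vs μ)) (cong (_∷ lincomb (v ∷ vs) (m ∷ μ)) (trans (+-identityʳ _) (zeroʳ m)))

  basis-independent : ∀ n → Independent (basis n)
  basis-independent n ls eq = trans (sym (lincomb-basis n ls)) eq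

  subst-independent : ∀ {j} (eq : k ≡ j) (vs : Vec (Vector n) k) → Independent vs → Independent (subst (Vec (Vector n)) eq vs)
  subst-independent refl vs ind = ind

  orthogonalFamily : ∀ (cs : List (Vector n)) → length cs ℕ.+ k ≡ n →
    Σ (Vec (Vector n) k) λ ws → Independent ws × ListAll.All (λ c → All (c ⊥_) ws) cs
  orthogonalFamily {n} cs eq =
    restrictAll cs vs , restrictAll-independent cs vs (subst-independent (sym eq) _ (basis-independent n)) , restrictAll-⊥ cs vs
    where
    vs = subst (Vec (Vector n)) (sym eq) (basis n)

  ·-lincomb : ∀ (c : Vector n) (vs : Vec (Vector n) k) ls → c · lincomb vs ls ≡ Vec.map (c ·_) vs · ls
  ·-lincomb c []       []       = ·-0ᵥ c
  ·-lincomb c (v ∷ vs) (l ∷ ls) = begin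
    c · (l ⊙ v ⊕ lincomb vs ls)         ≡⟨ ·-⊕ c (l ⊙ v) (lincomb vs ls) ⟩
    c · (l ⊙ v) + c · lincomb vs ls     ≡⟨ cong₂ _+_ (trans (·-⊙ c l v) (*-comm l (c · v))) (·-lincomb c vs ls) ⟩
    (c · v) * l + Vec.map (c ·_) vs · ls ∎
    where open ≡-Reasoning

  lift : Point F n → Vector (suc n)
  lift x = 1# ∷ x

  lift-⊥⇒InHyperplane : ∀ x (h : Vector (suc n)) → lift x ⊥ h → InHyperplane F (Vec.tail h) (- Vec.head h) x
  lift-⊥⇒InHyperplane x (h₀ ∷ hs) x⊥h =
    trans (·-comm hs x) (trans (+-inverseʳ-unique (1# * h₀) (x · hs) x⊥h) (cong -_ (*-identityˡ h₀)))

  lift-⊥⇒tail≡0⇒≡0 : ∀ x (h : Vector (suc n)) → lift x ⊥ h → Vec.tail h ≡ 0ᵥ n → h ≡ 0ᵥ (suc n)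
  lift-⊥⇒tail≡0⇒≡0 x (h₀ ∷ _) x⊥h refl = cong (_∷ 0ᵥ _) (begin
    h₀                    ≡⟨ sym (*-identityˡ h₀) ⟩
    1# * h₀               ≡⟨ sym (+-identityʳ _) ⟩
    1# * h₀ + 0#          ≡⟨ cong (1# * h₀ +_) (sym (·-0ᵥ x)) ⟩
    1# * h₀ + x · 0ᵥ _    ≡⟨ x⊥h ⟩
    0#                    ∎)
    where open ≡-Reasoning

  record HyperplanePencil {d} (T : List (Point F d)) : Set where
    field
      normal   : Fin (suc q) → Point F d
      offset   : Fin (suc q) → Fin q
      normal≢0 : ∀ b → normal b ≢ zeroVec F d
      contains : ∀ b → ListAll.All (InHyperplane F (normal b) (offset b)) T
      slot     : Point F d → Fin (suc q)
      covers   : ∀ x → InHyperplane F (normal (slot x)) (offset (slot x)) x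

  -- One representative of each of the q + 1 points of the projective line over F_q.
  coefficients : Fin (suc q) → Vector 2
  coefficients Fin.zero    = 1# ∷ 0# ∷ []
  coefficients (Fin.suc r) = r ∷ - 1# ∷ []

  module _ {d} (w₁ w₂ : Vector (suc d)) where

    pencilNormal : Fin (suc q) → Vector (suc d)
    pencilNormal b = lincomb (w₁ ∷ w₂ ∷ []) (coefficients b)

    pencilNormal≢0 : Independent (w₁ ∷ w₂ ∷ []) → ∀ b → pencilNormal b ≢ 0ᵥ (suc d)
    pencilNormal≢0 independent Fin.zero    h≡0 = 0≢1 (sym (∷-injectiveˡ (independent (coefficients Fin.zero) h≡0)))
    pencilNormal≢0 independent (Fin.suc r) h≡0 = -1≢0 (∷-injectiveˡ (∷-injectiveʳ (independent (coefficients (Fin.suc r)) h≡0)))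

    pencilSlot : Point F d → Fin (suc q)
    pencilSlot x with lift x · w₁ ≟ 0#
    ... | yes _   = Fin.zero
    ... | no  ≢0  = Fin.suc (lift x · w₂ * proj₁ (inverse _ ≢0))

    lift-⊥-pencilSlot : ∀ x → lift x ⊥ pencilNormal (pencilSlot x)
    lift-⊥-pencilSlot x with lift x · w₁ ≟ 0#
    ... | yes g₁≡0 = begin
      lift x · pencilNormal Fin.zero           ≡⟨ ·-lincomb (lift x) (w₁ ∷ w₂ ∷ []) (coefficients Fin.zero) ⟩
      lift x · w₁ * 1# + (lift x · w₂ * 0# + 0#) ≡⟨ cong₂ (λ a b → a * 1# + (b + 0#)) g₁≡0 (zeroʳ _) ⟩
      0# * 1# + (0# + 0#)                      ≡⟨ trans (cong₂ _+_ (zeroˡ 1#) (+-identityʳ 0#)) (+-identityʳ 0#) ⟩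
      0#                                       ∎
      where open ≡-Reasoning
    ... | no g₁≢0 with inverse _ g₁≢0
    ...   | g₁⁻¹ , g₁g₁⁻¹≡1 = begin
      lift x · pencilNormal (Fin.suc (g₂ * g₁⁻¹))
        ≡⟨ ·-lincomb (lift x) (w₁ ∷ w₂ ∷ []) (coefficients (Fin.suc (g₂ * g₁⁻¹))) ⟩
      g₁ * (g₂ * g₁⁻¹) + (g₂ * - 1# + 0#)
        ≡⟨ cong₂ _+_ g₁[g₂g₁⁻¹]≡g₂ (trans (+-identityʳ _) (trans (sym (-‿distribʳ-* g₂ 1#)) (cong -_ (*-identityʳ g₂)))) ⟩
      g₂ + - g₂
        ≡⟨ -‿inverseʳ g₂ ⟩
      0# ∎
      where
      open ≡-Reasoning
      g₁ = lift x · w₁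
      g₂ = lift x · w₂
      g₁[g₂g₁⁻¹]≡g₂ : g₁ * (g₂ * g₁⁻¹) ≡ g₂
      g₁[g₂g₁⁻¹]≡g₂ = trans (x∙yz≈y∙xz g₁ g₂ g₁⁻¹) (trans (cong (g₂ *_) g₁g₁⁻¹≡1) (*-identityʳ g₂))

  length-lifts+2 : ∀ {d} {T : List (Point F d)} → suc (length T) ≡ d → length (List.map lift T) ℕ.+ 2 ≡ suc d
  length-lifts+2 {T = T} ∣T∣+1≡d =
    trans (cong (ℕ._+ 2) (length-map lift T)) (trans (ℕ.+-comm (length T) 2) (cong suc ∣T∣+1≡d))

  pencil : ∀ {d} (T : List (Point F d)) → 1 ℕ.≤ length T → suc (length T) ≡ d → HyperplanePencil T
  pencil (t List.∷ T) _ ∣T∣+1≡d with orthogonalFamily (List.map lift (t List.∷ T)) (length-lifts+2 {T = t List.∷ T} ∣T∣+1≡d)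
  ... | w₁ ∷ w₂ ∷ [] , independent , T⊥W = record
    { normal   = λ b → Vec.tail (h b)
    ; offset   = λ b → - Vec.head (h b)
    ; normal≢0 = λ b tail≡0 →
        pencilNormal≢0 w₁ w₂ independent b (lift-⊥⇒tail≡0⇒≡0 t (h b) (lift-⊥-h (ListAll.head T⊥W′) b) tail≡0)
    ; contains = λ b → ListAll.map (λ {x} x⊥W → lift-⊥⇒InHyperplane x (h b) (lift-⊥-h x⊥W b)) T⊥W′
    ; slot     = pencilSlot w₁ w₂
    ; covers   = λ x → lift-⊥⇒InHyperplane x (h (pencilSlot w₁ w₂ x)) (lift-⊥-pencilSlot w₁ w₂ x)
    }
    where
    h = pencilNormal w₁ w₂
    T⊥W′ = map⁻ T⊥W
    lift-⊥-h : ∀ {x} → All (lift x ⊥_) (w₁ ∷ w₂ ∷ []) → ∀ b → lift x ⊥ h b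
    lift-⊥-h {x} x⊥W b = ⊥-lincomb (lift x) (w₁ ∷ w₂ ∷ []) (coefficients b) x⊥W

module CoplanarCount {q : ℕ} (F : FieldOn q) where

  open import Data.Bool.Base using (Bool; true; false)
  open import Data.Nat.Base using (ℕ; suc; _+_; _*_; _∸_; _≡ᵇ_; _≤_; z≤n)
  open import Data.Nat.Properties using (+-comm; +-monoˡ-≤; m+n∸n≡m; module ≤-Reasoning)
  open import Data.Nat.Combinatorics using (_C_)
  open import Data.Nat.Tactic.RingSolver using (solve-∀)
  open import Data.Fin.Base using (Fin)
  open import Data.Fin.Subset using (Subset; ∣_∣; _∪_; _∩_; ∁)
  open import Data.Vec.Base as Vec using (Vec; fromList)
  open import Data.List.Base using (List; length)
  import Data.List.Relation.Unary.All as ListAll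
  open import Data.Product.Base using (∃; _,_; proj₁)
  open import Relation.Nullary using (does)
  open import Relation.Nullary.Decidable using (dec-true)
  open import Relation.Binary.PropositionalEquality
  open SubsetSum
  open FiberCount using (fiber; extensions; ExtendsAlongFibers; ∣∁T∣²≤extensions)
  open Selection
  open LinearAlgebra F using (HyperplanePencil; pencil)

  coplanarᵇ : ∀ {d N} → Vec (Point F d) N → Subset N → Bool
  coplanarᵇ {d} v S = does (coplanar? F d (select S v))

  fibers-coplanar : ∀ {e N} (v : Vec (Point F (suc e)) N) (T : Subset N) → ∣ T ∣ ≡ e → 1 ≤ e →
    ∃ λ (ys : Vec (Fin (suc q)) N) → ExtendsAlongFibers (coplanarᵇ v) T ys
  fibers-coplanar {e} v T ∣T∣≡e 1≤e = Vec.map slot v , λ b R R⊆U →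
    dec-true (coplanar? F (suc e) (select (T ∪ R) v))
      (normal b , offset b , normal≢0 b , select-∪ T R v (contains b)
        (ListAll.map (λ {x} slot≡b → subst (λ c → InHyperplane F (normal c) (offset c) x) slot≡b (covers x))
          (select-⊆ᵇfiber slot b R v (proj₁ (⊆ᵇ-∩ R (fiber (Vec.map slot v) b) (∁ T) R⊆U)))))
    where
    ∣selection∣≡e : length (select T v) ≡ e
    ∣selection∣≡e = trans (length-select T v) ∣T∣≡e
    open HyperplanePencil (pencil (select T v) (subst (1 ≤_) (sym ∣selection∣≡e) 1≤e) (cong suc ∣selection∣≡e))

  square-bound : ∀ {e N} (v : Vec (Point F (suc e)) N) (T : Subset N) → ∣ T ∣ ≡ e → 1 ≤ e →
    (N ∸ e) * (N ∸ e) ≤ suc q * (2 * extensions (coplanarᵇ v) (e + 2) T + (N ∸ e))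
  square-bound {e} {N} v T ∣T∣≡e 1≤e with fibers-coplanar v T ∣T∣≡e 1≤e
  ... | ys , extends = subst (λ m → m * m ≤ suc q * (2 * extensions (coplanarᵇ v) (e + 2) T + m)) ∣∁T∣≡N∸e
    (subst (λ k → ∣ ∁ T ∣ * ∣ ∁ T ∣ ≤ suc q * (2 * extensions (coplanarᵇ v) (k + 2) T + ∣ ∁ T ∣)) ∣T∣≡e
      (∣∁T∣²≤extensions T ys (coplanarᵇ v) extends))
    where
    ∣∁T∣≡N∸e : ∣ ∁ T ∣ ≡ N ∸ e
    ∣∁T∣≡N∸e = sym (trans (cong (_∸ e) (trans (sym (∣∁∣+∣∣ T)) (cong (∣ ∁ T ∣ +_) ∣T∣≡e))) (m+n∸n≡m ∣ ∁ T ∣ e))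

  coplanarCount-as-∑ₛ : ∀ e (P : List (Point F (suc e))) →
    coplanarCount F (suc e) P ≡ ∑ₛ (length P) (λ S → ⟦ ∣ S ∣ ≡ᵇ e + 2 ⟧ * ⟦ coplanarᵇ (fromList P) S ⟧)
  coplanarCount-as-∑ₛ e P = trans (length-filter-combinations (coplanar? F (suc e)) (suc (suc e)) P)
    (cong (λ k → ∑ₛ (length P) (λ S → ⟦ ∣ S ∣ ≡ᵇ k ⟧ * ⟦ coplanarᵇ (fromList P) S ⟧)) (+-comm 2 e))

  coplanar-square-bound : ∀ e (P : List (Point F (suc e))) → 1 ≤ e →
    (length P ∸ e) * (length P ∸ e) * (length P C e)
      ≤ suc q * (2 * (((e + 2) C e) * coplanarCount F (suc e) P) + (length P ∸ e) * (length P C e))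
  coplanar-square-bound e P 1≤e = begin
    M * M * (N C e)
      ≡⟨ sym (∑ₛ-size-* N e (M * M)) ⟩
    ∑ₛ N (λ T → sized T * (M * M))
      ≤⟨ ∑ₛ-mono N per-T ⟩
    ∑ₛ N (λ T → sized T * (B * (2 * X T + M)))
      ≡⟨ ∑ₛ-cong N (λ T → expand (sized T) B (X T) M) ⟩
    ∑ₛ N (λ T → B * (2 * (sized T * X T)) + sized T * (B * M))
      ≡⟨ ∑ₛ-distrib-+ N _ _ ⟩
    ∑ₛ N (λ T → B * (2 * (sized T * X T))) + ∑ₛ N (λ T → sized T * (B * M))
      ≡⟨ cong₂ _+_ (sym (trans (cong (B *_) (*-distribˡ-∑ₛ N 2 _)) (*-distribˡ-∑ₛ N B _))) (∑ₛ-size-* N e (B * M)) ⟩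
    B * (2 * ∑ₛ N (λ T → sized T * X T)) + B * M * (N C e)
      ≡⟨ cong (λ x → B * (2 * x) + B * M * (N C e)) double-count ⟩
    B * (2 * (K * cnt)) + B * M * (N C e)
      ≡⟨ collect B (K * cnt) M (N C e) ⟩
    B * (2 * (K * cnt) + M * (N C e)) ∎
    where
    open ≤-Reasoning
    N = length P
    M = N ∸ e
    B = suc q
    K = (e + 2) C e
    cnt = coplanarCount F (suc e) P
    sized : Subset N → ℕ
    sized T = ⟦ ∣ T ∣ ≡ᵇ e ⟧
    X = extensions (coplanarᵇ (fromList P)) (e + 2)
    per-T : ∀ T → sized T * (M * M) ≤ sized T * (B * (2 * X T + M))
    per-T T with ∣ T ∣ ≡ᵇ e in ∣T∣≡ᵇe
    ... | false = z≤n
    ... | true  = +-monoˡ-≤ 0 (square-bound (fromList P) T (≡ᵇ-true⇒≡ ∣T∣≡ᵇe) 1≤e)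
    double-count : ∑ₛ N (λ T → sized T * X T) ≡ K * cnt
    double-count = trans (∑ₛ-supersets N e (e + 2) (λ S → ⟦ coplanarᵇ (fromList P) S ⟧))
      (cong (K *_) (sym (coplanarCount-as-∑ₛ e P)))
    expand : ∀ a B x M → a * (B * (2 * x + M)) ≡ B * (2 * (a * x)) + a * (B * M)
    expand = solve-∀
    collect : ∀ B s M C → B * (2 * s) + B * M * C ≡ B * (2 * s + M * C)
    collect = solve-∀

module PowerBound where

  open import Data.Nat.Base using (suc; _+_; _*_; _∸_; _^_; _!; _≤_)
  open import Data.Nat.Properties
  open import Data.Nat.Combinatorics using (_C_)
  open import Data.Nat.Tactic.RingSolver using (solve-∀)
  open import Data.Product.Base using (_,_)
  open import Relation.Binary.PropositionalEquality
  open Binomial using (n^k≤2^k*k!*nCk)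

  square≤⇒gap≤ : ∀ B t C Y → (B + t) * (B + t) * C ≤ B * (Y + (B + t) * C) → t * (B + t) * C ≤ B * Y
  square≤⇒gap≤ B t C Y square≤ = +-cancelʳ-≤ (B * (B + t) * C) (t * (B + t) * C) (B * Y) (begin
    t * (B + t) * C + B * (B + t) * C   ≡⟨ split B t C ⟩
    (B + t) * (B + t) * C               ≤⟨ square≤ ⟩
    B * (Y + (B + t) * C)               ≡⟨ distribute B Y (B + t) C ⟩
    B * Y + B * (B + t) * C             ∎)
    where
    open ≤-Reasoning
    split : ∀ B t C → t * (B + t) * C + B * (B + t) * C ≡ (B + t) * (B + t) * C
    split = solve-∀
    distribute : ∀ B Y M C → B * (Y + M * C) ≡ B * Y + B * M * C
    distribute = solve-∀

  power-bound : ∀ e q N c → 1 ≤ q → q + 2 * (suc e + 1) ≤ N →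
    (N ∸ e) * (N ∸ e) * (N C e) ≤ suc q * (2 * (((e + 2) C e) * c) + (N ∸ e) * (N C e)) →
    (N ∸ q) * N ^ suc e ≤ 16 * (2 ^ e * (e ! * ((e + 2) C e))) * q * c
  -- Writing N = q + 2 (e + 2) + o turns each estimate below into a ring identity plus monotonicity.
  power-bound e q N c 1≤q N-large square≤ with m≤n⇒∃[o]m+o≡n N-large
  ... | o , refl = begin
    (N′ ∸ q) * (N′ * N′ ^ e)
      ≡⟨ cong (_* (N′ * N′ ^ e)) N′∸q≡e+1+t ⟩
    (suc e + t) * (N′ * N′ ^ e)
      ≤⟨ *-mono-≤ e+1+t≤2t (*-mono-≤ N′≤2M (n^k≤2^k*k!*nCk {k = e} N′≤2[N′∸e])) ⟩
    (2 * t) * ((2 * M) * (2 ^ e * (e ! * Cₑ)))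
      ≡⟨ regroup t M (2 ^ e) (e !) Cₑ ⟩
    4 * (2 ^ e * e !) * (t * M * Cₑ)
      ≤⟨ *-monoʳ-≤ (4 * (2 ^ e * e !)) gap≤ ⟩
    4 * (2 ^ e * e !) * (B * (2 * (K * c)))
      ≤⟨ *-monoʳ-≤ (4 * (2 ^ e * e !)) (*-monoˡ-≤ (2 * (K * c)) B≤2q) ⟩
    4 * (2 ^ e * e !) * (2 * q * (2 * (K * c)))
      ≡⟨ collect (2 ^ e) (e !) q K c ⟩
    16 * (2 ^ e * (e ! * K)) * q * c ∎
    where
    open ≤-Reasoning
    N′ = q + 2 * (suc e + 1) + o
    B = suc q
    t = 3 + e + o
    M = B + t
    K = (e + 2) C e
    Cₑ = N′ C e
    N′≡M+e : N′ ≡ M + e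
    N′≡M+e = shift q e o
      where
      shift : ∀ q e o → q + 2 * (suc e + 1) + o ≡ (suc q + (3 + e + o)) + e
      shift = solve-∀
    N′∸e≡M : N′ ∸ e ≡ M
    N′∸e≡M = trans (cong (_∸ e) N′≡M+e) (m+n∸n≡m M e)
    N′∸q≡e+1+t : N′ ∸ q ≡ suc e + t
    N′∸q≡e+1+t = trans (cong (_∸ q) (shift q e o)) (m+n∸m≡n q (suc e + t))
      where
      shift : ∀ q e o → q + 2 * (suc e + 1) + o ≡ q + (suc e + (3 + e + o))
      shift = solve-∀
    e+1+t≤2t : suc e + t ≤ 2 * t
    e+1+t≤2t = ≤-trans (+-monoˡ-≤ t (≤-trans (m≤n+m (suc e) 2) (m≤m+n _ o))) (≤-reflexive (cong (t +_) (sym (+-identityʳ t))))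
    N′≤2M : N′ ≤ 2 * M
    N′≤2M = ≤-trans (≤-reflexive N′≡M+e)
      (≤-trans (+-monoʳ-≤ M (≤-trans (≤-trans (m≤n+m e 3) (m≤m+n _ o)) (m≤n+m t B)))
               (≤-reflexive (cong (M +_) (sym (+-identityʳ M)))))
    N′≤2[N′∸e] : N′ ≤ 2 * (N′ ∸ e)
    N′≤2[N′∸e] = subst (λ m → N′ ≤ 2 * m) (sym N′∸e≡M) N′≤2M
    gap≤ : t * M * Cₑ ≤ B * (2 * (K * c))
    gap≤ = square≤⇒gap≤ B t Cₑ (2 * (K * c)) (subst (λ m → m * m * Cₑ ≤ B * (2 * (K * c) + m * Cₑ)) N′∸e≡M square≤)
    B≤2q : B ≤ 2 * q
    B≤2q = ≤-trans (+-monoˡ-≤ q 1≤q) (≤-reflexive (cong (q +_) (sym (+-identityʳ q))))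
    regroup : ∀ t M p f C → (2 * t) * ((2 * M) * (p * (f * C))) ≡ 4 * (p * f) * (t * M * C)
    regroup = solve-∀
    collect : ∀ p f q K c → 4 * (p * f) * (2 * q * (2 * (K * c))) ≡ 16 * (p * (f * K)) * q * c
    collect = solve-∀

module RationalBound where

  open import Data.Nat.Base as ℕ using (ℕ; suc)
  import Data.Nat.Properties as ℕ
  open import Data.Nat.Tactic.RingSolver using (solve-∀)
  open import Data.Integer.Base as ℤ using (+_; +≤+)
  import Data.Integer.Properties as ℤ
  import Data.Integer.GCD as ℤ
  import Data.Integer.Tactic.RingSolver as ℤ
  open import Data.Rational.Base using (ℚ; _/_; _*_; _+_; _-_; _⊓_; 1ℚ; _≤_; toℚᵘ; ↥_; ↧_)
  open import Data.Rational.Properties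
  open import Data.Rational.Unnormalised.Base as ℚᵘ using (mkℚᵘ; *≡*; *≤*)
  import Data.Rational.Unnormalised.Properties as ℚᵘ
  open import Data.Rational.Solver using (module +-*-Solver)
  open import Relation.Nullary using (yes; no)
  open import Relation.Binary.PropositionalEquality

  fromℕ : ℕ → ℚ
  fromℕ n = + n / 1

  toℚᵘ-/ : ∀ a b → toℚᵘ ((+ a) / suc b) ℚᵘ.≃ mkℚᵘ (+ a) b
  toℚᵘ-/ a b = *≡* (begin
    ℚᵘ.↥ (toℚᵘ p) ℤ.* + suc b    ≡⟨ cong (ℤ._* + suc b) (↥ᵘ-toℚᵘ p) ⟩
    ↥ p ℤ.* + suc b              ≡⟨ cong (↥ p ℤ.*_) (sym (↧-/ (+ a) (suc b))) ⟩
    ↥ p ℤ.* (↧ p ℤ.* g)          ≡⟨ swap (↥ p) (↧ p) g ⟩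
    (↥ p ℤ.* g) ℤ.* ↧ p          ≡⟨ cong (ℤ._* ↧ p) (↥-/ (+ a) (suc b)) ⟩
    + a ℤ.* ↧ p                  ≡⟨ cong (+ a ℤ.*_) (sym (↧ᵘ-toℚᵘ p)) ⟩
    + a ℤ.* ℚᵘ.↧ (toℚᵘ p)        ∎)
    where
    open ≡-Reasoning
    p = (+ a) / suc b
    g = ℤ.gcd (+ a) (+ suc b)
    swap : ∀ x y z → x ℤ.* (y ℤ.* z) ≡ (x ℤ.* z) ℤ.* y
    swap = ℤ.solve-∀

  /-*-fromℕ : ∀ a b → ((+ a) / suc b) * fromℕ (suc b) ≡ fromℕ a
  /-*-fromℕ a b = toℚᵘ-injective (ℚᵘ.≃-trans (toℚᵘ-homo-* ((+ a) / suc b) (fromℕ (suc b)))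
    (ℚᵘ.≃-trans (ℚᵘ.*-cong (toℚᵘ-/ a b) (toℚᵘ-/ (suc b) 0)) (ℚᵘ.≃-trans (*≡* cross) (ℚᵘ.≃-sym (toℚᵘ-/ a 0)))))
    where
    cross : ((+ a) ℤ.* (+ suc b)) ℤ.* (+ 1) ≡ (+ a) ℤ.* (+ suc (b ℕ.* 1))
    cross = trans (ℤ.*-identityʳ _) (cong (λ x → (+ a) ℤ.* (+ suc x)) (sym (ℕ.*-identityʳ b)))

  fromℕ-mono-≤ : ∀ {m n} → m ℕ.≤ n → fromℕ m ≤ fromℕ n
  fromℕ-mono-≤ {m} {n} m≤n = toℚᵘ-cancel-≤ (ℚᵘ.≤-respʳ-≃ (ℚᵘ.≃-sym (toℚᵘ-/ n 0)) (ℚᵘ.≤-respˡ-≃ (ℚᵘ.≃-sym (toℚᵘ-/ m 0))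
    (*≤* (subst₂ ℤ._≤_ (sym (ℤ.*-identityʳ (+ m))) (sym (ℤ.*-identityʳ (+ n))) (+≤+ m≤n)))))

  fromℕ-* : ∀ m n → fromℕ (m ℕ.* n) ≡ fromℕ m * fromℕ n
  fromℕ-* m n = toℚᵘ-injective (ℚᵘ.≃-trans (toℚᵘ-/ (m ℕ.* n) 0)
    (ℚᵘ.≃-trans (*≡* (cong (ℤ._* + 1) (ℤ.pos-* m n)))
    (ℚᵘ.≃-sym (ℚᵘ.≃-trans (toℚᵘ-homo-* (fromℕ m) (fromℕ n)) (ℚᵘ.*-cong (toℚᵘ-/ m 0) (toℚᵘ-/ n 0))))))

  fromℕ-+ : ∀ m n → fromℕ (m ℕ.+ n) ≡ fromℕ m + fromℕ n
  fromℕ-+ m n = toℚᵘ-injective (ℚᵘ.≃-trans (toℚᵘ-/ (m ℕ.+ n) 0)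
    (ℚᵘ.≃-trans (*≡* (cong (ℤ._* + 1) (trans (ℤ.pos-+ m n) (sym (cong₂ ℤ._+_ (ℤ.*-identityʳ (+ m)) (ℤ.*-identityʳ (+ n)))))))
    (ℚᵘ.≃-sym (ℚᵘ.≃-trans (toℚᵘ-homo-+ (fromℕ m) (fromℕ n)) (ℚᵘ.+-cong (toℚᵘ-/ m 0) (toℚᵘ-/ n 0))))))

  ≤-fromℕ : ∀ {x} m .{{_ : ℕ.NonZero m}} n k → x * fromℕ m ≡ fromℕ n → n ℕ.≤ k ℕ.* m → x ≤ fromℕ k
  ≤-fromℕ {x} m n k xm≡n n≤km = *-cancelʳ-≤-pos (fromℕ m) {{normalize-pos m 1}}
    (subst₂ _≤_ (sym xm≡n) (fromℕ-* k m) (fromℕ-mono-≤ n≤km))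

  scaled-below : ∀ D b N a′ → suc b ℕ.≤ N →
    ((+ 1) / suc D) * (((+ N) / suc b) - 1ℚ) * ((+ a′) / suc b) * fromℕ (suc D ℕ.* suc b ℕ.* suc b)
      ≡ fromℕ ((N ℕ.∸ suc b) ℕ.* a′)
  scaled-below D b N a′ q≤N = begin
    u * (v - 1ℚ) * w * fromℕ (suc D ℕ.* suc b ℕ.* suc b)
      ≡⟨ cong (u * (v - 1ℚ) * w *_) (trans (fromℕ-* (suc D ℕ.* suc b) (suc b)) (cong (_* y) (fromℕ-* (suc D) (suc b)))) ⟩
    u * (v - 1ℚ) * w * (x * y * y)
      ≡⟨ regroup u v w x y ⟩
    (u * x) * (v * y - y) * (w * y)
      ≡⟨ cong₂ (λ ux vy → ux * (vy - y) * (w * y)) (/-*-fromℕ 1 D) (/-*-fromℕ N b) ⟩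
    1ℚ * (fromℕ N - y) * (w * y)
      ≡⟨ cong₂ (λ n wy → 1ℚ * (n - y) * wy) N≡ (/-*-fromℕ a′ b) ⟩
    1ℚ * ((fromℕ (N ℕ.∸ suc b) + y) - y) * fromℕ a′
      ≡⟨ cancel (fromℕ (N ℕ.∸ suc b)) y (fromℕ a′) ⟩
    fromℕ (N ℕ.∸ suc b) * fromℕ a′
      ≡⟨ sym (fromℕ-* (N ℕ.∸ suc b) a′) ⟩
    fromℕ ((N ℕ.∸ suc b) ℕ.* a′) ∎
    where
    open ≡-Reasoning
    open +-*-Solver
    u = (+ 1) / suc D
    v = (+ N) / suc b
    w = (+ a′) / suc b
    x = fromℕ (suc D)
    y = fromℕ (suc b)
    N≡ : fromℕ N ≡ fromℕ (N ℕ.∸ suc b) + y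
    N≡ = trans (cong fromℕ (sym (ℕ.m∸n+n≡m q≤N))) (fromℕ-+ (N ℕ.∸ suc b) (suc b))
    regroup : ∀ u v w x y → u * (v - 1ℚ) * w * (x * y * y) ≡ (u * x) * (v * y - y) * (w * y)
    regroup = solve 5 (λ u v w x y → u :* (v :- con 1ℚ) :* w :* (x :* y :* y) := (u :* x) :* (v :* y :- y) :* (w :* y)) refl
    cancel : ∀ x y z → 1ℚ * ((x + y) - y) * z ≡ x * z
    cancel = solve 3 (λ x y z → con 1ℚ :* ((x :+ y) :- y) :* z := x :* z) refl

  scaled-above : ∀ D b a′ → ((+ 1) / suc D) * 1ℚ * ((+ a′) / suc b) * fromℕ (suc D ℕ.* suc b) ≡ fromℕ a′
  scaled-above D b a′ = begin
    u * 1ℚ * w * fromℕ (suc D ℕ.* suc b)               ≡⟨ cong (u * 1ℚ * w *_) (fromℕ-* (suc D) (suc b)) ⟩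
    u * 1ℚ * w * (fromℕ (suc D) * fromℕ (suc b))        ≡⟨ regroup u w (fromℕ (suc D)) (fromℕ (suc b)) ⟩
    (u * fromℕ (suc D)) * (w * fromℕ (suc b))           ≡⟨ cong₂ _*_ (/-*-fromℕ 1 D) (/-*-fromℕ a′ b) ⟩
    1ℚ * fromℕ a′                                       ≡⟨ *-identityˡ (fromℕ a′) ⟩
    fromℕ a′                                            ∎
    where
    open ≡-Reasoning
    open +-*-Solver
    u = (+ 1) / suc D
    w = (+ a′) / suc b
    regroup : ∀ u w x y → u * 1ℚ * w * (x * y) ≡ (u * x) * (w * y)
    regroup = solve 4 (λ u w x y → u :* con 1ℚ :* w :* (x :* y) := (u :* x) :* (w :* y)) refl

  scale-mono : ∀ D b p {m m′} → m ≤ m′ → ((+ 1) / suc D) * m * ((+ p) / suc b) ≤ ((+ 1) / suc D) * m′ * ((+ p) / suc b)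
  scale-mono D b p m≤m′ = *-monoʳ-≤-nonNeg ((+ p) / suc b) {{normalize-nonNeg p (suc b)}}
    (*-monoˡ-≤-nonNeg ((+ 1) / suc D) {{normalize-nonNeg 1 (suc D)}} m≤m′)

  Nⁿ⁺¹≡Nⁿ*N : ∀ N n → N ℕ.^ (n ℕ.+ 1) ≡ N ℕ.^ n ℕ.* N
  Nⁿ⁺¹≡Nⁿ*N N n = trans (ℕ.^-distribˡ-+-* N n 1) (cong (N ℕ.^ n ℕ.*_) (ℕ.*-identityʳ N))

  power-bound-when-N≤2q : ∀ D q N n k → N ℕ.≤ 2 ℕ.* q → (N ℕ.∸ q) ℕ.* N ℕ.^ n ℕ.≤ D ℕ.* q ℕ.* k →
    (N ℕ.∸ q) ℕ.* N ℕ.^ (n ℕ.+ 1) ℕ.≤ k ℕ.* (suc (2 ℕ.* D) ℕ.* q ℕ.* q)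
  power-bound-when-N≤2q D q N n k N≤2q gap-bound = begin
    (N ℕ.∸ q) ℕ.* N ℕ.^ (n ℕ.+ 1)        ≡⟨ cong ((N ℕ.∸ q) ℕ.*_) (Nⁿ⁺¹≡Nⁿ*N N n) ⟩
    (N ℕ.∸ q) ℕ.* (N ℕ.^ n ℕ.* N)        ≡⟨ sym (ℕ.*-assoc (N ℕ.∸ q) (N ℕ.^ n) N) ⟩
    (N ℕ.∸ q) ℕ.* N ℕ.^ n ℕ.* N          ≤⟨ ℕ.*-mono-≤ gap-bound N≤2q ⟩
    D ℕ.* q ℕ.* k ℕ.* (2 ℕ.* q)          ≡⟨ regroup D q k ⟩
    k ℕ.* (2 ℕ.* D ℕ.* q ℕ.* q)          ≤⟨ ℕ.*-monoʳ-≤ k (ℕ.*-monoˡ-≤ q (ℕ.*-monoˡ-≤ q (ℕ.n≤1+n (2 ℕ.* D)))) ⟩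
    k ℕ.* (suc (2 ℕ.* D) ℕ.* q ℕ.* q)    ∎
    where
    open ℕ.≤-Reasoning
    regroup : ∀ D q k → D ℕ.* q ℕ.* k ℕ.* (2 ℕ.* q) ≡ k ℕ.* (2 ℕ.* D ℕ.* q ℕ.* q)
    regroup = solve-∀

  power-bound-when-2q≤N : ∀ D q N n k → 2 ℕ.* q ℕ.≤ N → (N ℕ.∸ q) ℕ.* N ℕ.^ n ℕ.≤ D ℕ.* q ℕ.* k →
    N ℕ.^ (n ℕ.+ 1) ℕ.≤ k ℕ.* (suc (2 ℕ.* D) ℕ.* q)
  power-bound-when-2q≤N D q N n k 2q≤N gap-bound = begin
    N ℕ.^ (n ℕ.+ 1)                      ≡⟨ Nⁿ⁺¹≡Nⁿ*N N n ⟩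
    N ℕ.^ n ℕ.* N                        ≤⟨ ℕ.*-monoʳ-≤ (N ℕ.^ n) N≤2[N∸q] ⟩
    N ℕ.^ n ℕ.* (2 ℕ.* (N ℕ.∸ q))        ≡⟨ regroup (N ℕ.^ n) (N ℕ.∸ q) ⟩
    2 ℕ.* ((N ℕ.∸ q) ℕ.* N ℕ.^ n)        ≤⟨ ℕ.*-monoʳ-≤ 2 gap-bound ⟩
    2 ℕ.* (D ℕ.* q ℕ.* k)                ≡⟨ regroup′ D q k ⟩
    k ℕ.* (2 ℕ.* D ℕ.* q)                ≤⟨ ℕ.*-monoʳ-≤ k (ℕ.*-monoˡ-≤ q (ℕ.n≤1+n (2 ℕ.* D))) ⟩
    k ℕ.* (suc (2 ℕ.* D) ℕ.* q)          ∎
    where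
    open ℕ.≤-Reasoning
    q+q≤N : q ℕ.+ q ℕ.≤ N
    q+q≤N = subst (ℕ._≤ N) (cong (q ℕ.+_) (ℕ.+-identityʳ q)) 2q≤N
    N≤2[N∸q] : N ℕ.≤ 2 ℕ.* (N ℕ.∸ q)
    N≤2[N∸q] = begin
      N                          ≡⟨ sym (ℕ.m∸n+n≡m (ℕ.m+n≤o⇒m≤o q q+q≤N)) ⟩
      (N ℕ.∸ q) ℕ.+ q            ≤⟨ ℕ.+-monoʳ-≤ (N ℕ.∸ q) (ℕ.m+n≤o⇒m≤o∸n q q+q≤N) ⟩
      (N ℕ.∸ q) ℕ.+ (N ℕ.∸ q)    ≡⟨ cong ((N ℕ.∸ q) ℕ.+_) (sym (ℕ.+-identityʳ (N ℕ.∸ q))) ⟩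
      2 ℕ.* (N ℕ.∸ q)            ∎
    regroup : ∀ x y → x ℕ.* (2 ℕ.* y) ≡ 2 ℕ.* (y ℕ.* x)
    regroup = solve-∀
    regroup′ : ∀ D q k → 2 ℕ.* (D ℕ.* q ℕ.* k) ≡ k ℕ.* (2 ℕ.* D ℕ.* q)
    regroup′ = solve-∀

  rational-bound : ∀ D b N n k → suc b ℕ.≤ N → (N ℕ.∸ suc b) ℕ.* N ℕ.^ n ℕ.≤ D ℕ.* suc b ℕ.* k →
    ((+ 1) / suc (2 ℕ.* D)) * ((((+ N) / suc b) - 1ℚ) ⊓ 1ℚ) * ((+ (N ℕ.^ (n ℕ.+ 1))) / suc b) ≤ fromℕ k
  rational-bound D b N n k q≤N gap-bound with N ℕ.≤? 2 ℕ.* suc b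
  ... | yes N≤2q = ≤-trans (scale-mono (2 ℕ.* D) b (N ℕ.^ (n ℕ.+ 1)) (p⊓q≤p (((+ N) / suc b) - 1ℚ) 1ℚ))
    (≤-fromℕ (suc (2 ℕ.* D) ℕ.* suc b ℕ.* suc b) ((N ℕ.∸ suc b) ℕ.* N ℕ.^ (n ℕ.+ 1)) k
      (scaled-below (2 ℕ.* D) b N (N ℕ.^ (n ℕ.+ 1)) q≤N) (power-bound-when-N≤2q D (suc b) N n k N≤2q gap-bound))
  ... | no  N≰2q = ≤-trans (scale-mono (2 ℕ.* D) b (N ℕ.^ (n ℕ.+ 1)) (p⊓q≤q (((+ N) / suc b) - 1ℚ) 1ℚ))
    (≤-fromℕ (suc (2 ℕ.* D) ℕ.* suc b) (N ℕ.^ (n ℕ.+ 1)) k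
      (scaled-above (2 ℕ.* D) b (N ℕ.^ (n ℕ.+ 1))) (power-bound-when-2q≤N D (suc b) N n k (ℕ.<⇒≤ (ℕ.≰⇒> N≰2q)) gap-bound))

open import Data.Nat as ℕ using (ℕ; suc; _≤_; NonZero)
open import Data.Integer using (+_)
open import Data.Rational as ℚ using (ℚ; Positive; _/_; _⊓_; _-_; _*_; 1ℚ)
open import Data.List using (List; length)
open import Data.List.Relation.Unary.Unique.Propositional using (Unique)
open import Data.Product using (Σ; _×_)
open import Data.Nat.Base using (z≤n; s≤s; _!)
open import Data.Nat.Properties using (m+n≤o⇒m≤o)
open import Data.Nat.Combinatorics using (_C_)
open import Data.Rational.Properties using (normalize-pos)
open import Data.Product using (_,_)

lemma4p1 : ∀ (d : ℕ) → 2 ≤ d →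
    Σ ℚ λ c → Positive c ×
    (∀ (q : ℕ) .{{_ : NonZero q}} (F : FieldOn q) → 2 ℕ.* (d ℕ.+ 1) ≤ q →
    ∀ (P : List (Point F d)) → Unique P →
    q ℕ.+ 2 ℕ.* (d ℕ.+ 1) ≤ length P →
    c * ((((+ length P) / q) - 1ℚ) ⊓ 1ℚ) * ((+ (length P ℕ.^ (d ℕ.+ 1))) / q)
    ℚ.≤ ((+ coplanarCount F d P) / 1))
lemma4p1 (suc (suc e′)) (s≤s (s≤s z≤n)) =
  (+ 1) / suc (2 ℕ.* D) , normalize-pos 1 (suc (2 ℕ.* D)) ,
  λ { (suc b) F _ P _ N-large →
      RationalBound.rational-bound D b (length P) (suc e) (coplanarCount F (suc e) P)
        (m+n≤o⇒m≤o (suc b) N-large)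
        (PowerBound.power-bound e (suc b) (length P) (coplanarCount F (suc e) P) (s≤s z≤n) N-large
          (CoplanarCount.coplanar-square-bound F e P (s≤s z≤n))) }
  where
  e = suc e′
  D = 16 ℕ.* (2 ℕ.^ e ℕ.* (e ! ℕ.* ((e ℕ.+ 2) C e)))
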